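{- Let $w$ be a permutation. The Hasse diagram of $\mathcal{P}(w)$ is a tree in which no element covers at least $3$ elements if and only if $w$ avoids the patterns $2413$ and $3142$ and $w$ has no interval $I$ such that the subword of $w$ formed by the letters of $I$ is order-isomorphic to a direct sum $p_1 \oplus \cdots \oplus p_r$ or a skew sum $p_1 \ominus \cdots \ominus p_r$ of $r \ge 3$ (nonempty) permutations.
   Context: For $w \in \mathfrak{S}_n$ in one-line notation $w(1)\cdots w(n)$, an interval of $w$ is a set of consecutive integers $[h,h+j]$ with $\{w(t) : t \in [i,i+j]\} = [h,h+j]$ for some $i$; the interval poset $\mathcal{P}(w)$ is the set of nonempty intervals of $w$ ordered by inclusion. For $p \in \mathfrak{S}_a$, $q \in \mathfrak{S}_b$, $p \oplus q = p(1)\cdots p(a)\,(q(1)+a)\cdots(q(b)+a)$ and $p \ominus q = (p(1)+b)\cdots(p(a)+b)\,q(1)\cdots q(b)$. A permutation $w$ avoids a pattern $\pi \in \mathfrak{S}_k$ if no subsequence $w(i_1)\cdots w(i_k)$ with $i_1<\cdots<i_k$ is order-isomorphic to $\pi$. -}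

module Defs where

open import Data.Nat as ℕ using (ℕ; zero; suc; _+_; _≤_; _<_)
open import Data.Fin as Fin using (Fin; toℕ; splitAt; _↑ˡ_; _↑ʳ_; cast)
open import Data.Fin.Patterns
open import Data.Nat.Properties using (+-comm)
open import Data.List using (List; []; _∷_; _++_; [_]; length; map)
open import Data.Nat.ListAction using (sum)
open import Data.List.Relation.Unary.All using (All)
open import Data.List.Relation.Unary.Linked using (Linked)
open import Data.List.Relation.Unary.Unique.Propositional using (Unique)
open import Data.Product using (Σ; ∃; _×_; _,_; proj₁)
open import Data.Sum using (_⊎_; inj₁; inj₂)
open import Data.Empty using (⊥)
open import Relation.Nullary using (¬_)
open import Relation.Binary.PropositionalEquality using (_≡_; _≢_)
open import Relation.Binary.Construct.Closure.ReflexiveTransitive using (Star)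
open import Function using (_⇔_)
open import Function.Definitions using (Injective)

-- Permutations of size n are injective maps Fin n → Fin n (values 0-indexed).
IsPerm : {n : ℕ} → (Fin n → Fin n) → Set
IsPerm w = Injective _≡_ _≡_ w

-- Intervals.  A pair (h , len) with len ≥ 1 denotes the set of integers
-- [h, h+len-1] (i.e. [h, h+j] with j = len - 1).

_∈I_ : ℕ → ℕ × ℕ → Set
x ∈I (h , len) = (h ≤ x) × (x < h + len)

IsIntervalAt : {n : ℕ} → (Fin n → Fin n) → ℕ × ℕ → ℕ → Set
IsIntervalAt {n} w (h , len) i =
  (1 ≤ len) × (i + len ≤ n) ×
  (∀ (x : ℕ) → (x ∈I (h , len)) ⇔
     (∃ λ (t : Fin n) → (i ≤ toℕ t) × (toℕ t < i + len) × (toℕ (w t) ≡ x)))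

IsInterval : {n : ℕ} → (Fin n → Fin n) → ℕ × ℕ → Set
IsInterval w I = ∃ λ i → IsIntervalAt w I i

_⊆I_ : ℕ × ℕ → ℕ × ℕ → Set
I ⊆I J = ∀ x → x ∈I I → x ∈I J

_⊂I_ : ℕ × ℕ → ℕ × ℕ → Set
I ⊂I J = (I ⊆I J) × (I ≢ J)

-- Interval poset P(w): elements are the (nonempty) intervals of w,
-- ordered by inclusion.  B covers A in P(w):
Covers : {n : ℕ} → (Fin n → Fin n) → ℕ × ℕ → ℕ × ℕ → Set
Covers w B A =
  IsInterval w A × IsInterval w B × (A ⊂I B) ×
  (∀ C → IsInterval w C → A ⊂I C → C ⊂I B → ⊥)

HasseAdj : {n : ℕ} → (Fin n → Fin n) → ℕ × ℕ → ℕ × ℕ → Set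
HasseAdj w A B = Covers w A B ⊎ Covers w B A

HasseConnected : {n : ℕ} → (Fin n → Fin n) → Set
HasseConnected w =
  ∀ A B → IsInterval w A → IsInterval w B → Star (HasseAdj w) A B

HasseCycle : {n : ℕ} → (Fin n → Fin n) → List (ℕ × ℕ) → Set
HasseCycle w [] = ⊥
HasseCycle w (v ∷ vs) =
  (2 ≤ length vs) × Unique (v ∷ vs) × Linked (HasseAdj w) ((v ∷ vs) ++ [ v ])

HasseAcyclic : {n : ℕ} → (Fin n → Fin n) → Set
HasseAcyclic w = ∀ cs → ¬ HasseCycle w cs

HasseIsTree : {n : ℕ} → (Fin n → Fin n) → Set
HasseIsTree w = HasseConnected w × HasseAcyclic w

NoElementCovers3 : {n : ℕ} → (Fin n → Fin n) → Set
NoElementCovers3 w = ∀ B A₁ A₂ A₃ →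
  Covers w B A₁ → Covers w B A₂ → Covers w B A₃ →
  (A₁ ≡ A₂) ⊎ (A₁ ≡ A₃) ⊎ (A₂ ≡ A₃)

Contains : {n k : ℕ} → (Fin n → Fin n) → (Fin k → Fin k) → Set
Contains {n} {k} w π =
  ∃ λ (f : Fin k → Fin n) →
    (∀ a b → a Fin.< b → f a Fin.< f b) ×
    (∀ a b → (w (f a) Fin.< w (f b)) ⇔ (π a Fin.< π b))

Avoids : {n k : ℕ} → (Fin n → Fin n) → (Fin k → Fin k) → Set
Avoids w π = ¬ Contains w π

-- 2413 and 3142 (0-indexed values)
p2413 : Fin 4 → Fin 4
p2413 0F = 1F
p2413 1F = 3F
p2413 2F = 0F
p2413 3F = 2F

p3142 : Fin 4 → Fin 4
p3142 0F = 2F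
p3142 1F = 0F
p3142 2F = 3F
p3142 3F = 1F

_⊕_ : {a b : ℕ} → (Fin a → Fin a) → (Fin b → Fin b) → Fin (a + b) → Fin (a + b)
_⊕_ {a} {b} p q x with splitAt a x
... | inj₁ i = p i ↑ˡ b
... | inj₂ j = a ↑ʳ q j

_⊖_ : {a b : ℕ} → (Fin a → Fin a) → (Fin b → Fin b) → Fin (a + b) → Fin (a + b)
_⊖_ {a} {b} p q x with splitAt a x
... | inj₁ i = cast (+-comm b a) (b ↑ʳ p i)
... | inj₂ j = cast (+-comm b a) (q j ↑ˡ a)

SizedPerm : Set
SizedPerm = Σ ℕ λ a → Fin a → Fin a

totalSize : List SizedPerm → ℕ
totalSize ps = sum (map proj₁ ps)

⨁ : (ps : List SizedPerm) → Fin (totalSize ps) → Fin (totalSize ps)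
⨁ [] ()
⨁ ((a , p) ∷ ps) = p ⊕ ⨁ ps

⨀ : (ps : List SizedPerm) → Fin (totalSize ps) → Fin (totalSize ps)
⨀ [] ()
⨀ ((a , p) ∷ ps) = p ⊖ ⨀ ps

GoodPart : SizedPerm → Set
GoodPart (a , p) = (1 ≤ a) × IsPerm p

SubwordIso : {n k : ℕ} → (Fin n → Fin n) → ℕ → ℕ → (Fin k → Fin k) → Set
SubwordIso {n} {k} w i len σ =
  (len ≡ k) ×
  (∀ (a b : Fin k) (t s : Fin n) → toℕ t ≡ i + toℕ a → toℕ s ≡ i + toℕ b →
     (w t Fin.< w s) ⇔ (σ a Fin.< σ b))

HasSumInterval : {n : ℕ} → (Fin n → Fin n) → Set
HasSumInterval w =
  ∃ λ (I : ℕ × ℕ) → ∃ λ (i : ℕ) → IsIntervalAt w I i ×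
    (∃ λ (ps : List SizedPerm) → (3 ≤ length ps) × All GoodPart ps ×
       (SubwordIso w i (proj₂' I) (⨁ ps) ⊎ SubwordIso w i (proj₂' I) (⨀ ps)))
  where
    proj₂' : ℕ × ℕ → ℕ
    proj₂' (_ , l) = l

-- Two
-- crossing intervals (overlapping without nesting) cut their union into three consecutive
-- blocks, i.e. a sum of three permutations; conversely, in a sum of r ≥ 3 permutations the
-- first two and the last r − 1 summands form crossing intervals.  So "no sum interval" says
-- that the intervals form a laminar family.  A laminar family has an acyclic Hasse diagram,
-- and acyclicity forces laminarity, since a suitably minimal crossing pair X, Y gives the
-- 4-cycle X ∩ Y, X, X ∪ Y, Y.  In a laminar family, "no element covers three" means that
-- every interval of length ≥ 2 is halved by the two intervals it covers: a left and a right
-- block whose values lie entirely below or entirely above each other; such halvings make the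
-- diagram connected.  Repeated halving never cuts through an occurrence of 2413 or 3142,
-- since both are simple permutations.  Conversely, if w avoids 2413 and 3142 every interval
-- can be halved: a split point is found by induction on the length, extending a split point
-- of the interval without its last letter.
module Submission where

open import Defs
open import Data.Nat
open import Data.Nat.Properties
open import Data.Fin as F using (Fin; toℕ; fromℕ<; splitAt; _↑ˡ_; _↑ʳ_)
open import Data.Fin.Patterns
import Data.Fin.Properties as FP
open import Data.Product
open import Data.Product.Properties using (≡-dec)
open import Data.Product.Function.NonDependent.Propositional using (_×-⇔_)
open import Data.Sum using (_⊎_; inj₁; inj₂; [_,_]′)
import Data.Sum as Sum
open import Data.Sum.Function.Propositional using (_⊎-⇔_)
open import Data.Empty
open import Data.List using (List; []; _∷_; _++_; [_])
open import Data.List.Properties using (++-assoc)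
open import Data.List.Relation.Unary.All as All using (All; []; _∷_)
import Data.List.Relation.Unary.All.Properties as AllP
open import Data.List.Relation.Unary.AllPairs using ([]; _∷_)
open import Data.List.Relation.Unary.Linked using (Linked; []; [-]; _∷_)
open import Data.List.Relation.Unary.Unique.Propositional using (Unique)
open import Relation.Binary.PropositionalEquality hiding ([_])
open import Relation.Binary.Definitions using (tri<; tri≈; tri>)
open import Relation.Binary.Construct.Closure.ReflexiveTransitive using (Star; ε; _◅_; _◅◅_; reverse)
open import Relation.Nullary
open import Relation.Nullary.Decidable using (_×-dec_)
open import Function using (_⇔_; mk⇔; Equivalence)
open import Function.Construct.Composition using (_⇔-∘_)
open import Function.Construct.Symmetry using (⇔-sym)
open import Function.Related.TypeIsomorphisms using (¬-cong-⇔)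

∈I-start : ∀ i {l} → 1 ≤ l → i ∈I (i , l)
∈I-start i l≥1 = ≤-refl , m<m+n i l≥1

∈I-offset : ∀ i {l} (y : Fin l) → (i + toℕ y) ∈I (i , l)
∈I-offset i y = m≤m+n i (toℕ y) , +-monoʳ-< i (FP.toℕ<n y)

∈I-last : ∀ i m → (i + m) ∈I (i , suc m)
∈I-last i m = m≤m+n i m , +-monoʳ-< i (n<1+n m)

∈I-suc⁺ : ∀ {x i m} → x ∈I (i , m) → x ∈I (i , suc m)
∈I-suc⁺ {i = i} {m} (i≤x , x<) = i≤x , <-≤-trans x< (+-monoʳ-≤ i (n≤1+n m))

∈I-suc⁻ : ∀ {x i m} → x ∈I (i , suc m) → x ∈I (i , m) ⊎ x ≡ i + m
∈I-suc⁻ {x} {i} {m} (i≤x , x<) with m≤n⇒m<n∨m≡n (≤-pred (subst (x <_) (+-suc i m) x<))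
... | inj₁ x<i+m = inj₁ (i≤x , x<i+m)
... | inj₂ x≡i+m = inj₂ x≡i+m

∉I-empty : ∀ {x i} → ¬ x ∈I (i , 0)
∉I-empty {x} {i} (i≤x , x<) = <-irrefl refl (≤-<-trans i≤x (subst (x <_) (+-identityʳ i) x<))

∈I-singleton : ∀ {x a} → x ∈I (a , 1) → x ≡ a
∈I-singleton {x} {a} (a≤x , x<) = ≤-antisym (≤-pred (subst (x <_) (+-comm a 1) x<)) a≤x

∈I⇒∸< : ∀ {x h l} → x ∈I (h , l) → x ∸ h < l
∈I⇒∸< {h = h} {l} (h≤x , x<) = +-cancelˡ-< h _ _ (subst (_< h + l) (sym (m+[n∸m]≡n h≤x)) x<)

∈I-∸-⇔ : ∀ {a b x} → a ≤ b → x ∈I (a , b ∸ a) ⇔ (a ≤ x × x < b)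
∈I-∸-⇔ {x = x} a≤b =
  mk⇔ (λ (p , q) → p , subst (x <_) (m+[n∸m]≡n a≤b) q)
      (λ (p , q) → p , subst (x <_) (sym (m+[n∸m]≡n a≤b)) q)

any∈I? : {P : ℕ → Set} → (∀ x → Dec (P x)) → ∀ i m → Dec (∃ λ x → x ∈I (i , m) × P x)
any∈I? P? i zero = no λ (x , x∈ , _) → ∉I-empty x∈
any∈I? {P} P? i (suc m) with any∈I? P? i m | P? (i + m)
... | yes (x , x∈ , px) | _ = yes (x , ∈I-suc⁺ x∈ , px)
... | no _ | yes p = yes (i + m , ∈I-last i m , p)
... | no ¬q | no ¬p = no λ (x , x∈ , px) →
  [ (λ x∈′ → ¬q (x , x∈′ , px)) , (λ eq → ¬p (subst P eq px)) ]′ (∈I-suc⁻ x∈)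

all∈I? : {P : ℕ → Set} → (∀ x → Dec (P x)) → ∀ i m → Dec (∀ x → x ∈I (i , m) → P x)
all∈I? P? i zero = yes λ x x∈ → ⊥-elim (∉I-empty x∈)
all∈I? {P} P? i (suc m) with all∈I? P? i m | P? (i + m)
... | no ¬q | _ = no λ f → ¬q λ x x∈ → f x (∈I-suc⁺ x∈)
... | yes _ | no ¬p = no λ f → ¬p (f (i + m) (∈I-last i m))
... | yes q | yes p = yes λ x x∈ → [ q x , (λ eq → subst P (sym eq) p) ]′ (∈I-suc⁻ x∈)

range-injection⇒≤ : ∀ {a} (f : Fin a → ℕ) c b → (∀ x y → f x ≡ f y → x ≡ y) →
  (∀ x → f x ∈I (c , b)) → a ≤ b
range-injection⇒≤ f c b f-inj f∈ = FP.injective⇒≤ {f = g} g-inj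
  where
    g : Fin _ → Fin b
    g x = fromℕ< (∈I⇒∸< (f∈ x))
    g-inj : ∀ {x y} → g x ≡ g y → x ≡ y
    g-inj {x} {y} eq = f-inj x y (begin
      f x           ≡⟨ m+[n∸m]≡n (proj₁ (f∈ x)) ⟨
      c + (f x ∸ c) ≡⟨ cong (c +_) (FP.fromℕ<-injective _ _ (∈I⇒∸< (f∈ x)) (∈I⇒∸< (f∈ y)) eq) ⟩
      c + (f y ∸ c) ≡⟨ m+[n∸m]≡n (proj₁ (f∈ y)) ⟩
      f y           ∎)
      where open ≡-Reasoning

∸≡⇒+≡ : ∀ {i j a} → i ≤ j → j ∸ i ≡ a → i + a ≡ j
∸≡⇒+≡ i≤j refl = m+[n∸m]≡n i≤j

+-∸-shift : ∀ g s {v} → g + s ≤ v → s + (v ∸ (g + s)) ≡ v ∸ g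
+-∸-shift g s {v} g+s≤v = begin
  s + (v ∸ (g + s))           ≡⟨ m+n∸m≡n g _ ⟨
  g + (s + (v ∸ (g + s))) ∸ g ≡⟨ cong (_∸ g) (+-assoc g s _) ⟨
  g + s + (v ∸ (g + s)) ∸ g   ≡⟨ cong (_∸ g) (m+[n∸m]≡n g+s≤v) ⟩
  v ∸ g                       ∎
  where open ≡-Reasoning

∸-<-⇔ : ∀ {g x y} → g ≤ x → g ≤ y → (x < y) ⇔ (x ∸ g < y ∸ g)
∸-<-⇔ {g} g≤x g≤y = mk⇔ (λ lt → ∸-monoˡ-< lt g≤x)
  (λ lt → subst₂ _<_ (m+[n∸m]≡n g≤x) (m+[n∸m]≡n g≤y) (+-monoʳ-< g lt))

∸-telescope : ∀ {a b c} → a ≤ b → b ≤ c → (b ∸ a) + (c ∸ b) ≡ c ∸ a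
∸-telescope {a} {b} {c} a≤b b≤c = begin
  (b ∸ a) + (c ∸ b)           ≡⟨ m+n∸m≡n a _ ⟨
  a + ((b ∸ a) + (c ∸ b)) ∸ a ≡⟨ cong (_∸ a) (+-assoc a _ _) ⟨
  a + (b ∸ a) + (c ∸ b) ∸ a   ≡⟨ cong (λ z → z + (c ∸ b) ∸ a) (m+[n∸m]≡n a≤b) ⟩
  b + (c ∸ b) ∸ a             ≡⟨ cong (_∸ a) (m+[n∸m]≡n b≤c) ⟩
  c ∸ a                       ∎
  where open ≡-Reasoning

-- The trailing + 0 matches the size totalSize of a list of three summands.
∸-telescope₃ : ∀ {a b c d} → a ≤ b → b ≤ c → c ≤ d → (b ∸ a) + ((c ∸ b) + ((d ∸ c) + 0)) ≡ d ∸ a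
∸-telescope₃ {a} {b} {c} {d} a≤b b≤c c≤d = begin
  (b ∸ a) + ((c ∸ b) + ((d ∸ c) + 0)) ≡⟨ cong (λ z → (b ∸ a) + ((c ∸ b) + z)) (+-identityʳ _) ⟩
  (b ∸ a) + ((c ∸ b) + (d ∸ c))       ≡⟨ cong ((b ∸ a) +_) (∸-telescope b≤c c≤d) ⟩
  (b ∸ a) + (d ∸ b)                   ≡⟨ ∸-telescope a≤b (≤-trans b≤c c≤d) ⟩
  d ∸ a                               ∎
  where open ≡-Reasoning

∸-telescope₃ʳ : ∀ {a b c d} → a ≤ b → b ≤ c → c ≤ d → (d ∸ c) + ((c ∸ b) + ((b ∸ a) + 0)) ≡ d ∸ a
∸-telescope₃ʳ {a} {b} {c} {d} a≤b b≤c c≤d = begin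
  (d ∸ c) + ((c ∸ b) + ((b ∸ a) + 0)) ≡⟨ cong (λ z → (d ∸ c) + ((c ∸ b) + z)) (+-identityʳ _) ⟩
  (d ∸ c) + ((c ∸ b) + (b ∸ a))       ≡⟨ cong ((d ∸ c) +_) (+-comm (c ∸ b) _ ) ⟩
  (d ∸ c) + ((b ∸ a) + (c ∸ b))       ≡⟨ cong ((d ∸ c) +_) (∸-telescope a≤b b≤c) ⟩
  (d ∸ c) + (c ∸ a)                   ≡⟨ +-comm (d ∸ c) _ ⟩
  (c ∸ a) + (d ∸ c)                   ≡⟨ ∸-telescope (≤-trans a≤b b≤c) c≤d ⟩
  d ∸ a                               ∎
  where open ≡-Reasoning

bounds⇒⊆I : ∀ {h l g m} → g ≤ h → h + l ≤ g + m → (h , l) ⊆I (g , m)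
bounds⇒⊆I g≤h h+l≤g+m x (h≤x , x<h+l) = ≤-trans g≤h h≤x , <-≤-trans x<h+l h+l≤g+m

⊆I-refl : ∀ {A} → A ⊆I A
⊆I-refl x x∈ = x∈

⊆I-trans : ∀ {A B C} → A ⊆I B → B ⊆I C → A ⊆I C
⊆I-trans A⊆B B⊆C x x∈ = B⊆C x (A⊆B x x∈)

later-start-⊂I : ∀ {h h′ a b} → h < h′ → h′ + a ≡ h + b → (h′ , a) ⊂I (h , b)
later-start-⊂I h<h′ same-end = bounds⇒⊆I (<⇒≤ h<h′) (≤-reflexive same-end) , λ eq → <-irrefl (cong proj₁ (sym eq)) h<h′

earlier-end-⊂I : ∀ {h a b} → h + a < h + b → (h , a) ⊂I (h , b)
earlier-end-⊂I h+a<h+b = bounds⇒⊆I ≤-refl (<⇒≤ h+a<h+b) , λ eq → <-irrefl (cong (λ (x , y) → x + y) eq) h+a<h+b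

Disjoint : ℕ × ℕ → ℕ × ℕ → Set
Disjoint A B = ∀ x → x ∈I A → x ∈I B → ⊥

apart⇒Disjoint : ∀ {h l g m} → h + l ≤ g ⊎ g + m ≤ h → Disjoint (h , l) (g , m)
apart⇒Disjoint (inj₁ h+l≤g) x (_ , x<h+l) (g≤x , _) = <-irrefl refl (<-≤-trans x<h+l (≤-trans h+l≤g g≤x))
apart⇒Disjoint (inj₂ g+m≤h) x (h≤x , _) (_ , x<g+m) = <-irrefl refl (<-≤-trans x<g+m (≤-trans g+m≤h h≤x))

range-halves : ∀ a p q → ((a , p) ⊆I (a , p + q)) × ((a + p , q) ⊆I (a , p + q)) ×
  Disjoint (a , p) (a + p , q) × (∀ x → x ∈I (a , p + q) → x ∈I (a , p) ⊎ x ∈I (a + p , q))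
range-halves a p q =
  bounds⇒⊆I ≤-refl (+-monoʳ-≤ a (m≤m+n p q)) ,
  bounds⇒⊆I (m≤m+n a p) (≤-reflexive (+-assoc a p q)) ,
  (λ x (_ , x<a+p) (a+p≤x , _) → <-irrefl refl (<-≤-trans x<a+p a+p≤x)) ,
  split
  where
    split : ∀ x → x ∈I (a , p + q) → x ∈I (a , p) ⊎ x ∈I (a + p , q)
    split x (a≤x , x<) with x <? a + p
    ... | yes x<a+p = inj₁ (a≤x , x<a+p)
    ... | no x≮a+p = inj₂ (≮⇒≥ x≮a+p , subst (x <_) (sym (+-assoc a p q)) x<)

disjoint-subranges-tile : ∀ {h l h₁ l₁ h₂ l₂} → l₁ + l₂ ≡ l →
  h ≤ h₁ × h₁ + l₁ ≤ h + l → h ≤ h₂ × h₂ + l₂ ≤ h + l → 1 ≤ l₁ → 1 ≤ l₂ → Disjoint (h₁ , l₁) (h₂ , l₂) →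
  (h₁ ≡ h × h₂ ≡ h + l₁) ⊎ (h₂ ≡ h × h₁ ≡ h + l₂)
disjoint-subranges-tile {h} {l} {h₁} {l₁} {h₂} {l₂} l₁+l₂≡l (h≤h₁ , end₁≤) (h≤h₂ , end₂≤) l₁≥1 l₂≥1 disjoint
  with h₁ + l₁ ≤? h₂ | h₂ + l₂ ≤? h₁
... | yes end₁≤h₂ | _ = inj₁ (h₁≡h , ≤-antisym h₂≤ (subst (_≤ h₂) (cong (_+ l₁) h₁≡h) end₁≤h₂))
  where
    h+l≡ : h + l ≡ h + l₁ + l₂
    h+l≡ = trans (cong (h +_) (sym l₁+l₂≡l)) (sym (+-assoc h l₁ l₂))
    h₁≡h : h₁ ≡ h
    h₁≡h = ≤-antisym (+-cancelʳ-≤ (l₁ + l₂) h₁ h (subst₂ _≤_ (+-assoc h₁ l₁ l₂) (trans h+l≡ (+-assoc h l₁ l₂))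
             (≤-trans (+-monoˡ-≤ l₂ end₁≤h₂) end₂≤))) h≤h₁
    h₂≤ : h₂ ≤ h + l₁
    h₂≤ = +-cancelʳ-≤ l₂ h₂ (h + l₁) (subst (h₂ + l₂ ≤_) h+l≡ end₂≤)
... | no _ | yes end₂≤h₁ = inj₂ (h₂≡h , ≤-antisym h₁≤ (subst (_≤ h₁) (cong (_+ l₂) h₂≡h) end₂≤h₁))
  where
    h+l≡ : h + l ≡ h + l₂ + l₁
    h+l≡ = trans (cong (h +_) (trans (sym l₁+l₂≡l) (+-comm l₁ l₂))) (sym (+-assoc h l₂ l₁))
    h₂≡h : h₂ ≡ h
    h₂≡h = ≤-antisym (+-cancelʳ-≤ (l₂ + l₁) h₂ h (subst₂ _≤_ (+-assoc h₂ l₂ l₁) (trans h+l≡ (+-assoc h l₂ l₁))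
             (≤-trans (+-monoˡ-≤ l₁ end₂≤h₁) end₁≤))) h≤h₂
    h₁≤ : h₁ ≤ h + l₂
    h₁≤ = +-cancelʳ-≤ l₁ h₁ (h + l₂) (subst (h₁ + l₁ ≤_) h+l≡ end₁≤)
... | no end₁≰h₂ | no end₂≰h₁ with h₁ ≤? h₂
...   | yes h₁≤h₂ = ⊥-elim (disjoint h₂ (h₁≤h₂ , ≰⇒> end₁≰h₂) (∈I-start h₂ l₂≥1))
...   | no h₁≰h₂ = ⊥-elim (disjoint h₁ (∈I-start h₁ l₁≥1) (<⇒≤ (≰⇒> h₁≰h₂) , ≰⇒> end₂≰h₁))

data RangeOrder (a s b r : ℕ) : Set where
  within    : b ≤ a → a + s ≤ b + r → RangeOrder a s b r
  around    : a ≤ b → b + r ≤ a + s → RangeOrder a s b r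
  apart     : a + s ≤ b ⊎ b + r ≤ a → RangeOrder a s b r
  crossingˡ : a < b → b < a + s → a + s < b + r → RangeOrder a s b r
  crossingʳ : b < a → a < b + r → b + r < a + s → RangeOrder a s b r

compareRanges : ∀ a s b r → RangeOrder a s b r
compareRanges a s b r with <-cmp a b
... | tri< a<b _ _ with a + s ≤? b | b + r ≤? a + s
...   | yes a+s≤b | _        = apart (inj₁ a+s≤b)
...   | no _      | yes ⊇    = around (<⇒≤ a<b) ⊇
...   | no a+s≰b  | no ⊉     = crossingˡ a<b (≰⇒> a+s≰b) (≰⇒> ⊉)
compareRanges a s b r | tri≈ _ refl _ with a + s ≤? b + r
...   | yes ⊆ = within ≤-refl ⊆
...   | no ⊈  = around ≤-refl (<⇒≤ (≰⇒> ⊈))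
compareRanges a s b r | tri> _ _ b<a with b + r ≤? a | a + s ≤? b + r
...   | yes b+r≤a | _       = apart (inj₂ b+r≤a)
...   | no _      | yes ⊆   = within (<⇒≤ b<a) ⊆
...   | no b+r≰a  | no ⊈    = crossingʳ b<a (≰⇒> b+r≰a) (≰⇒> ⊈)

module Crossing {u s v r : ℕ} (u<v : u < v) (v<u+s : v < u + s) (u+s<v+r : u + s < v + r) where

  onlyˡ : ∀ x → (u ≤ x × x < v) ⇔ (x ∈I (u , s) × ¬ x ∈I (v , r))
  onlyˡ x = mk⇔
    (λ (u≤x , x<v) → (u≤x , <-trans x<v v<u+s) , (λ (v≤x , _) → <-irrefl refl (<-≤-trans x<v v≤x)))
    (λ ((u≤x , x<u+s) , x∉) → u≤x , ≰⇒> (λ v≤x → x∉ (v≤x , <-trans x<u+s u+s<v+r)))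

  both : ∀ x → (v ≤ x × x < u + s) ⇔ (x ∈I (u , s) × x ∈I (v , r))
  both x = mk⇔
    (λ (v≤x , x<u+s) → (≤-trans (<⇒≤ u<v) v≤x , x<u+s) , (v≤x , <-trans x<u+s u+s<v+r))
    (λ ((_ , x<u+s) , (v≤x , _)) → v≤x , x<u+s)

  onlyʳ : ∀ x → (u + s ≤ x × x < v + r) ⇔ (¬ x ∈I (u , s) × x ∈I (v , r))
  onlyʳ x = mk⇔
    (λ (u+s≤x , x<v+r) → (λ (_ , x<u+s) → <-irrefl refl (<-≤-trans x<u+s u+s≤x)) ,
                          (≤-trans (<⇒≤ v<u+s) u+s≤x , x<v+r))
    (λ (x∉ , (v≤x , x<v+r)) → ≮⇒≥ (λ x<u+s → x∉ (≤-trans (<⇒≤ u<v) v≤x , x<u+s)) , x<v+r)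

  either : ∀ x → (u ≤ x × x < v + r) ⇔ (x ∈I (u , s) ⊎ x ∈I (v , r))
  either x = mk⇔ split
    [ (λ (u≤x , x<u+s) → u≤x , <-trans x<u+s u+s<v+r) , (λ (v≤x , x<v+r) → ≤-trans (<⇒≤ u<v) v≤x , x<v+r) ]′
    where
      split : u ≤ x × x < v + r → x ∈I (u , s) ⊎ x ∈I (v , r)
      split (u≤x , x<v+r) with x <? u + s
      ... | yes x<u+s = inj₁ (u≤x , x<u+s)
      ... | no x≮u+s = inj₂ (≤-trans (<⇒≤ v<u+s) (≮⇒≥ x≮u+s) , x<v+r)

prefix-or-inversion : {Q : ℕ → Set} → (∀ x → Dec (Q x)) → ∀ i e → i ≤ e →
  (∃ λ y → ∃ λ x → i ≤ y × y < x × x < e × ¬ Q y × Q x) ⊎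
  (∃ λ c → i ≤ c × c ≤ e × (∀ x → i ≤ x → x < c → Q x) × (∀ x → c ≤ x → x < e → ¬ Q x))
prefix-or-inversion Q? i zero i≤0 =
  inj₂ (i , ≤-refl , i≤0 , (λ x i≤x x<i → ⊥-elim (<-irrefl refl (≤-<-trans i≤x x<i))) , (λ x _ x<0 → ⊥-elim (n≮0 x<0)))
prefix-or-inversion {Q} Q? i (suc e) i≤1+e with i ≤? e
... | no i≰e = inj₂ (i , ≤-refl , i≤1+e , (λ x i≤x x<i → ⊥-elim (<-irrefl refl (≤-<-trans i≤x x<i))) ,
                     (λ x i≤x x<1+e → ⊥-elim (i≰e (≤-pred (≤-trans (s≤s i≤x) x<1+e)))))
... | yes i≤e with prefix-or-inversion Q? i e i≤e
...   | inj₁ (y , x , i≤y , y<x , x<e , ¬qy , qx) = inj₁ (y , x , i≤y , y<x , <-trans x<e (n<1+n e) , ¬qy , qx)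
...   | inj₂ (c , i≤c , c≤e , before , after) with Q? e
...     | no ¬qe = inj₂ (c , i≤c , ≤-trans c≤e (n≤1+n e) , before ,
            λ x c≤x x<1+e → [ after x c≤x , (λ x≡e → subst (λ z → ¬ Q z) (sym x≡e) ¬qe) ]′ (m≤n⇒m<n∨m≡n (≤-pred x<1+e)))
...     | yes qe with c <? e
...       | yes c<e = inj₁ (c , e , i≤c , c<e , n<1+n e , after c ≤-refl c<e , qe)
...       | no c≮e = inj₂ (suc e , ≤-trans i≤e (n≤1+n e) , ≤-refl ,
              (λ x i≤x x<1+e → [ (λ x<e → before x i≤x (<-≤-trans x<e (≮⇒≥ c≮e))) , (λ x≡e → subst Q (sym x≡e) qe) ]′
                                 (m≤n⇒m<n∨m≡n (≤-pred x<1+e))) ,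
              (λ x 1+e≤x x<1+e → ⊥-elim (<-irrefl refl (<-≤-trans x<1+e 1+e≤x))))

snoc-view : ∀ {A : Set} (x : A) xs → ∃ λ ys → ∃ λ y → x ∷ xs ≡ ys ++ [ y ]
snoc-view x [] = [] , x , refl
snoc-view x (x′ ∷ xs) with snoc-view x′ xs
... | ys , y , eq = x ∷ ys , y , cong (x ∷_) eq

Linked-unsnoc : ∀ {A : Set} {R : A → A → Set} {a b} xs → Linked R (xs ++ a ∷ [ b ]) →
  Linked R (xs ++ [ a ]) × R a b
Linked-unsnoc [] (r ∷ [-]) = [-] , r
Linked-unsnoc (x ∷ []) (r ∷ rs) = map₁ (r ∷_) (Linked-unsnoc [] rs)
Linked-unsnoc (x ∷ x′ ∷ xs) (r ∷ rs) = map₁ (r ∷_) (Linked-unsnoc (x′ ∷ xs) rs)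

All-last : ∀ {A : Set} {P : A → Set} xs {y} → All P (xs ++ [ y ]) → P y
All-last xs ps with AllP.++⁻ʳ xs ps
... | p ∷ [] = p

toℕ-⊕ : ∀ {a b} (p : Fin a → Fin a) (q : Fin b → Fin b) (x : Fin (a + b)) →
  (Σ (Fin a) λ y → toℕ x ≡ toℕ y × toℕ ((p ⊕ q) x) ≡ toℕ (p y)) ⊎
  (Σ (Fin b) λ y → toℕ x ≡ a + toℕ y × toℕ ((p ⊕ q) x) ≡ a + toℕ (q y))
toℕ-⊕ {a} {b} p q x with splitAt a x in eq
... | inj₁ y = inj₁ (y , trans (cong toℕ (sym (FP.splitAt⁻¹-↑ˡ eq))) (FP.toℕ-↑ˡ y b) , FP.toℕ-↑ˡ (p y) b)
... | inj₂ y = inj₂ (y , trans (cong toℕ (sym (FP.splitAt⁻¹-↑ʳ eq))) (FP.toℕ-↑ʳ a y) , FP.toℕ-↑ʳ a (q y))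

toℕ-⊖ : ∀ {a b} (p : Fin a → Fin a) (q : Fin b → Fin b) (x : Fin (a + b)) →
  (Σ (Fin a) λ y → toℕ x ≡ toℕ y × toℕ ((p ⊖ q) x) ≡ b + toℕ (p y)) ⊎
  (Σ (Fin b) λ y → toℕ x ≡ a + toℕ y × toℕ ((p ⊖ q) x) ≡ toℕ (q y))
toℕ-⊖ {a} {b} p q x with splitAt a x in eq
... | inj₁ y = inj₁ (y , trans (cong toℕ (sym (FP.splitAt⁻¹-↑ˡ eq))) (FP.toℕ-↑ˡ y b) ,
                         trans (FP.toℕ-cast _ (b ↑ʳ p y)) (FP.toℕ-↑ʳ b (p y)))
... | inj₂ y = inj₂ (y , trans (cong toℕ (sym (FP.splitAt⁻¹-↑ʳ eq))) (FP.toℕ-↑ʳ a y) ,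
                         trans (FP.toℕ-cast _ (q y ↑ˡ a)) (FP.toℕ-↑ˡ (q y) a))

private
  <-≤-absurd : ∀ {x a y} → x < a → x ≡ a + y → ⊥
  <-≤-absurd {y = y} x<a refl = <-irrefl refl (<-≤-trans x<a (m≤m+n _ y))

  ≤-<-absurd : ∀ {a x} {y : Fin a} → a ≤ x → x ≡ toℕ y → ⊥
  ≤-<-absurd {y = y} a≤x refl = <-irrefl refl (<-≤-trans (FP.toℕ<n y) a≤x)

⊕-lower : ∀ {a b} (p : Fin a → Fin a) (q : Fin b → Fin b) (x : Fin (a + b)) →
  toℕ x < a → toℕ ((p ⊕ q) x) < a
⊕-lower p q x x<a with toℕ-⊕ p q x
... | inj₁ (y , _ , ev) = subst (_< _) (sym ev) (FP.toℕ<n (p y))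
... | inj₂ (y , ex , _) = ⊥-elim (<-≤-absurd x<a ex)

⊕-upper : ∀ {a b} (p : Fin a → Fin a) (q : Fin b → Fin b) (x : Fin (a + b)) → a ≤ toℕ x →
  Σ (Fin b) λ y → toℕ x ≡ a + toℕ y × toℕ ((p ⊕ q) x) ≡ a + toℕ (q y)
⊕-upper p q x a≤x with toℕ-⊕ p q x
... | inj₂ r = r
... | inj₁ (y , ex , _) = ⊥-elim (≤-<-absurd a≤x ex)

⊖-lower : ∀ {a b} (p : Fin a → Fin a) (q : Fin b → Fin b) (x : Fin (a + b)) →
  toℕ x < a → b ≤ toℕ ((p ⊖ q) x)
⊖-lower p q x x<a with toℕ-⊖ p q x
... | inj₁ (y , _ , ev) = subst (_ ≤_) (sym ev) (m≤m+n _ _)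
... | inj₂ (y , ex , _) = ⊥-elim (<-≤-absurd x<a ex)

⊖-upper : ∀ {a b} (p : Fin a → Fin a) (q : Fin b → Fin b) (x : Fin (a + b)) → a ≤ toℕ x →
  Σ (Fin b) λ y → toℕ x ≡ a + toℕ y × toℕ ((p ⊖ q) x) ≡ toℕ (q y)
⊖-upper p q x a≤x with toℕ-⊖ p q x
... | inj₂ r = r
... | inj₁ (y , ex , _) = ⊥-elim (≤-<-absurd a≤x ex)

⊕-separates : ∀ {a b} (p : Fin a → Fin a) (q : Fin b → Fin b) x y → toℕ x < a → a ≤ toℕ y →
  toℕ ((p ⊕ q) x) < toℕ ((p ⊕ q) y)
⊕-separates p q x y x<a a≤y with ⊕-upper p q y a≤y
... | _ , _ , v≡ = <-≤-trans (⊕-lower p q x x<a) (subst (_ ≤_) (sym v≡) (m≤m+n _ _))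

⊕-separates₂ : ∀ {a₁ a₂ b} (p₁ : Fin a₁ → Fin a₁) (p₂ : Fin a₂ → Fin a₂) (q : Fin b → Fin b) x y →
  toℕ x < a₁ + a₂ → a₁ + a₂ ≤ toℕ y → toℕ ((p₁ ⊕ (p₂ ⊕ q)) x) < toℕ ((p₁ ⊕ (p₂ ⊕ q)) y)
⊕-separates₂ {a₁} {a₂} p₁ p₂ q x y x< ≤y = <-≤-trans (low x x<) (high y ≤y)
  where
    low : ∀ x → toℕ x < a₁ + a₂ → toℕ ((p₁ ⊕ (p₂ ⊕ q)) x) < a₁ + a₂
    low x x< with toℕ x <? a₁
    ... | yes x<a₁ = <-≤-trans (⊕-lower p₁ _ x x<a₁) (m≤m+n a₁ a₂)
    ... | no x≮a₁ with ⊕-upper p₁ (p₂ ⊕ q) x (≮⇒≥ x≮a₁)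
    ...   | x′ , x≡ , v≡ = subst (_< a₁ + a₂) (sym v≡)
            (+-monoʳ-< a₁ (⊕-lower p₂ q x′ (+-cancelˡ-< a₁ _ _ (subst (_< a₁ + a₂) x≡ x<))))
    high : ∀ y → a₁ + a₂ ≤ toℕ y → a₁ + a₂ ≤ toℕ ((p₁ ⊕ (p₂ ⊕ q)) y)
    high y ≤y with ⊕-upper p₁ (p₂ ⊕ q) y (≤-trans (m≤m+n a₁ a₂) ≤y)
    ... | y′ , y≡ , v≡ with ⊕-upper p₂ q y′ (+-cancelˡ-≤ a₁ _ _ (subst (a₁ + a₂ ≤_) y≡ ≤y))
    ...   | _ , _ , v≡₂ = subst (a₁ + a₂ ≤_) (sym (trans v≡ (cong (a₁ +_) v≡₂))) (+-monoʳ-≤ a₁ (m≤m+n a₂ _))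

⊖-separates : ∀ {a b} (p : Fin a → Fin a) (q : Fin b → Fin b) x y → toℕ x < a → a ≤ toℕ y →
  toℕ ((p ⊖ q) y) < toℕ ((p ⊖ q) x)
⊖-separates {b = b} p q x y x<a a≤y with ⊖-upper p q y a≤y
... | y′ , _ , v≡ = <-≤-trans (subst (_< b) (sym v≡) (FP.toℕ<n (q y′))) (⊖-lower p q x x<a)

⊖-separates₂ : ∀ {a₁ a₂ b} (p₁ : Fin a₁ → Fin a₁) (p₂ : Fin a₂ → Fin a₂) (q : Fin b → Fin b) x y →
  toℕ x < a₁ + a₂ → a₁ + a₂ ≤ toℕ y → toℕ ((p₁ ⊖ (p₂ ⊖ q)) y) < toℕ ((p₁ ⊖ (p₂ ⊖ q)) x)
⊖-separates₂ {a₁} {a₂} {b} p₁ p₂ q x y x< ≤y = <-≤-trans (high y ≤y) (low x x<)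
  where
    low : ∀ x → toℕ x < a₁ + a₂ → b ≤ toℕ ((p₁ ⊖ (p₂ ⊖ q)) x)
    low x x< with toℕ x <? a₁
    ... | yes x<a₁ = ≤-trans (m≤n+m b a₂) (⊖-lower p₁ (p₂ ⊖ q) x x<a₁)
    ... | no x≮a₁ with ⊖-upper p₁ (p₂ ⊖ q) x (≮⇒≥ x≮a₁)
    ...   | x′ , x≡ , v≡ = subst (b ≤_) (sym v≡) (⊖-lower p₂ q x′ (+-cancelˡ-< a₁ _ _ (subst (_< a₁ + a₂) x≡ x<)))
    high : ∀ y → a₁ + a₂ ≤ toℕ y → toℕ ((p₁ ⊖ (p₂ ⊖ q)) y) < b
    high y ≤y with ⊖-upper p₁ (p₂ ⊖ q) y (≤-trans (m≤m+n a₁ a₂) ≤y)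
    ... | y′ , y≡ , v≡ with ⊖-upper p₂ q y′ (+-cancelˡ-≤ a₁ _ _ (subst (a₁ + a₂ ≤_) y≡ ≤y))
    ...   | y″ , _ , v≡₂ = subst (_< b) (sym (trans v≡ v≡₂)) (FP.toℕ<n (q y″))

increasing₄ : (W : Fin 4 → ℕ) → W 0F < W 1F → W 1F < W 2F → W 2F < W 3F →
  ∀ x y → x F.< y → W x < W y
increasing₄ W a b c 0F 1F _ = a
increasing₄ W a b c 0F 2F _ = <-trans a b
increasing₄ W a b c 0F 3F _ = <-trans a (<-trans b c)
increasing₄ W a b c 1F 2F _ = b
increasing₄ W a b c 1F 3F _ = <-trans b c
increasing₄ W a b c 2F 3F _ = c
increasing₄ W a b c 1F 1F (s≤s ())
increasing₄ W a b c 2F 1F (s≤s ())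
increasing₄ W a b c 3F 1F (s≤s ())
increasing₄ W a b c 2F 2F (s≤s (s≤s ()))
increasing₄ W a b c 3F 2F (s≤s (s≤s ()))
increasing₄ W a b c 3F 3F (s≤s (s≤s (s≤s ())))

increasing₄-⇔ : (W : Fin 4 → ℕ) → W 0F < W 1F → W 1F < W 2F → W 2F < W 3F →
  ∀ x y → (W x < W y) ⇔ (x F.< y)
increasing₄-⇔ W a b c x y = mk⇔ reflect (increasing₄ W a b c x y)
  where
    reflect : W x < W y → x F.< y
    reflect lt with <-cmp (toℕ x) (toℕ y)
    ... | tri< x<y _ _ = x<y
    ... | tri≈ _ x≡y _ = ⊥-elim (<-irrefl (cong W (FP.toℕ-injective x≡y)) lt)
    ... | tri> _ _ y<x = ⊥-elim (<-asym lt (increasing₄ W a b c y x y<x))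

CutAt : (Fin 4 → ℕ) → ℕ → Set
CutAt V t = (∀ a b → toℕ a < t → t ≤ toℕ b → V a < V b) ⊎ (∀ a b → toℕ a < t → t ≤ toℕ b → V b < V a)

OrderedBy : (Fin 4 → Fin 4) → (Fin 4 → ℕ) → Set
OrderedBy π V = ∀ a b → toℕ (π a) < toℕ (π b) → V a < V b

Simple : (Fin 4 → Fin 4) → Set
Simple π = ∀ V → OrderedBy π V → ∀ t → 1 ≤ t → t ≤ 3 → ¬ CutAt V t

2413-simple : Simple p2413
2413-simple V r 1 _ _ (inj₁ c) = <-asym (c 0F 2F (s≤s z≤n) (s≤s z≤n)) (r 2F 0F (s≤s z≤n))
2413-simple V r 1 _ _ (inj₂ c) = <-asym (c 0F 1F (s≤s z≤n) (s≤s z≤n)) (r 0F 1F (s≤s (s≤s z≤n)))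
2413-simple V r 2 _ _ (inj₁ c) = <-asym (c 1F 2F (s≤s (s≤s z≤n)) ≤-refl) (r 2F 1F (s≤s z≤n))
2413-simple V r 2 _ _ (inj₂ c) = <-asym (c 0F 3F (s≤s z≤n) (s≤s (s≤s z≤n))) (r 0F 3F (s≤s (s≤s z≤n)))
2413-simple V r 3 _ _ (inj₁ c) = <-asym (c 1F 3F (s≤s (s≤s z≤n)) ≤-refl) (r 3F 1F ≤-refl)
2413-simple V r 3 _ _ (inj₂ c) = <-asym (c 2F 3F ≤-refl ≤-refl) (r 2F 3F (s≤s z≤n))
2413-simple V r (suc (suc (suc (suc t)))) _ (s≤s (s≤s (s≤s ()))) _

3142-simple : Simple p3142
3142-simple V r 1 _ _ (inj₁ c) = <-asym (c 0F 1F (s≤s z≤n) (s≤s z≤n)) (r 1F 0F (s≤s z≤n))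
3142-simple V r 1 _ _ (inj₂ c) = <-asym (c 0F 2F (s≤s z≤n) (s≤s z≤n)) (r 0F 2F ≤-refl)
3142-simple V r 2 _ _ (inj₁ c) = <-asym (c 0F 3F (s≤s z≤n) (s≤s (s≤s z≤n))) (r 3F 0F (s≤s (s≤s z≤n)))
3142-simple V r 2 _ _ (inj₂ c) = <-asym (c 1F 2F (s≤s (s≤s z≤n)) ≤-refl) (r 1F 2F (s≤s z≤n))
3142-simple V r 3 _ _ (inj₁ c) = <-asym (c 2F 3F ≤-refl ≤-refl) (r 3F 2F (s≤s (s≤s z≤n)))
3142-simple V r 3 _ _ (inj₂ c) = <-asym (c 1F 3F (s≤s (s≤s z≤n)) ≤-refl) (r 1F 3F (s≤s z≤n))
3142-simple V r (suc (suc (suc (suc t)))) _ (s≤s (s≤s (s≤s ()))) _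

injective⇒surjective : ∀ {n} {f : Fin n → Fin n} → IsPerm f → ∀ y → ∃ λ x → f x ≡ y
injective⇒surjective {suc m} {f} f-inj y with FP.any? (λ x → f x F.≟ y)
... | yes hit = hit
... | no miss = ⊥-elim (<-irrefl refl (FP.injective⇒≤ {f = g} g-inj))
  where
    y≢f : ∀ x → y ≢ f x
    y≢f x eq = miss (x , sym eq)
    g : Fin (suc m) → Fin m
    g x = F.punchOut (y≢f x)
    g-inj : ∀ {x x′} → g x ≡ g x′ → x ≡ x′
    g-inj eq = f-inj (FP.punchOut-injective (y≢f _) (y≢f _) eq)

module OfPermutation {n : ℕ} (w : Fin n → Fin n) (w-inj : IsPerm w) where

  -- w read as a function on ℕ, with junk value 0 at positions p ≥ n.
  abstract
    val : ℕ → ℕ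
    val p with p <? n
    ... | yes p<n = toℕ (w (fromℕ< p<n))
    ... | no _ = 0

    val-toℕ : ∀ t → val (toℕ t) ≡ toℕ (w t)
    val-toℕ t with toℕ t <? n
    ... | yes t<n = cong (λ z → toℕ (w z)) (FP.fromℕ<-toℕ t t<n)
    ... | no t≮n = ⊥-elim (t≮n (FP.toℕ<n t))

  val-fromℕ< : ∀ {p} (p<n : p < n) → val p ≡ toℕ (w (fromℕ< p<n))
  val-fromℕ< p<n = trans (cong val (sym (FP.toℕ-fromℕ< p<n))) (val-toℕ (fromℕ< p<n))

  val<n : ∀ {p} → p < n → val p < n
  val<n p<n = subst (_< n) (sym (val-fromℕ< p<n)) (FP.toℕ<n _)

  val-injective : ∀ {p q} → p < n → q < n → val p ≡ val q → p ≡ q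
  val-injective {p} {q} p<n q<n eq = begin
    p                   ≡⟨ FP.toℕ-fromℕ< p<n ⟨
    toℕ (fromℕ< p<n)    ≡⟨ cong toℕ (w-inj (FP.toℕ-injective w≡)) ⟩
    toℕ (fromℕ< q<n)    ≡⟨ FP.toℕ-fromℕ< q<n ⟩
    q                   ∎
    where
      open ≡-Reasoning
      w≡ = trans (sym (val-fromℕ< p<n)) (trans eq (val-fromℕ< q<n))

  val-surjective : ∀ x → x < n → ∃ λ p → p < n × val p ≡ x
  val-surjective x x<n with injective⇒surjective w-inj (fromℕ< x<n)
  ... | t , wt≡x = toℕ t , FP.toℕ<n t , trans (val-toℕ t) (trans (cong toℕ wt≡x) (FP.toℕ-fromℕ< x<n))

  ∈I-fits : ∀ {p i l} → i + l ≤ n → p ∈I (i , l) → p < n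
  ∈I-fits i+l≤n (_ , p<i+l) = <-≤-trans p<i+l i+l≤n

  record Block (i h l : ℕ) : Set where
    field
      nonempty : 1 ≤ l
      fits     : i + l ≤ n
      image    : ∀ p → p ∈I (i , l) → val p ∈I (h , l)
      onto     : ∀ x → x ∈I (h , l) → ∃ λ p → p ∈I (i , l) × val p ≡ x

    preimage : ∀ p → p < n → val p ∈I (h , l) → p ∈I (i , l)
    preimage p p<n vp∈ with onto (val p) vp∈
    ... | p′ , p′∈ , eq = subst (_∈I (i , l)) (val-injective (∈I-fits fits p′∈) p<n eq) p′∈

    ∈-⇔ : ∀ p → p < n → (p ∈I (i , l)) ⇔ (val p ∈I (h , l))
    ∈-⇔ p p<n = mk⇔ (image p) (preimage p p<n)

    onto-< : ∀ x → x ∈I (h , l) → ∃ λ p → p < n × val p ≡ x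
    onto-< x x∈ with onto x x∈
    ... | p , p∈ , eq = p , ∈I-fits fits p∈ , eq

  open Block public

  Block-cong : ∀ {i h l i′ h′ l′} → i ≡ i′ → h ≡ h′ → l ≡ l′ → Block i h l → Block i′ h′ l′
  Block-cong refl refl refl B = B

  IsIntervalAt⇒Block : ∀ {h l i} → IsIntervalAt w (h , l) i → Block i h l
  IsIntervalAt⇒Block {h} {l} {i} (l≥1 , i+l≤n , values) = record
    { nonempty = l≥1 ; fits = i+l≤n ; image = image′ ; onto = onto′ }
    where
      image′ : ∀ p → p ∈I (i , l) → val p ∈I (h , l)
      image′ p (i≤p , p<i+l) = Equivalence.from (values (val p))
        (fromℕ< p<n , subst (i ≤_) (sym (FP.toℕ-fromℕ< p<n)) i≤p ,
         subst (_< i + l) (sym (FP.toℕ-fromℕ< p<n)) p<i+l , sym (val-fromℕ< p<n))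
        where p<n = <-≤-trans p<i+l i+l≤n
      onto′ : ∀ x → x ∈I (h , l) → ∃ λ p → p ∈I (i , l) × val p ≡ x
      onto′ x x∈ with Equivalence.to (values x) x∈
      ... | t , i≤t , t<i+l , wt≡x = toℕ t , (i≤t , t<i+l) , trans (val-toℕ t) wt≡x

  Block⇒IsIntervalAt : ∀ {h l i} → Block i h l → IsIntervalAt w (h , l) i
  Block⇒IsIntervalAt {h} {l} {i} B = nonempty B , fits B , λ x → mk⇔ (to x) (from x)
    where
      to : ∀ x → x ∈I (h , l) → ∃ λ (t : Fin n) → (i ≤ toℕ t) × (toℕ t < i + l) × (toℕ (w t) ≡ x)
      to x x∈ with onto B x x∈
      ... | p , (i≤p , p<i+l) , vp≡x =
        let p<n = <-≤-trans p<i+l (fits B) in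
        fromℕ< p<n , subst (i ≤_) (sym (FP.toℕ-fromℕ< p<n)) i≤p ,
        subst (_< i + l) (sym (FP.toℕ-fromℕ< p<n)) p<i+l , trans (sym (val-fromℕ< p<n)) vp≡x
      from : ∀ x → (∃ λ (t : Fin n) → (i ≤ toℕ t) × (toℕ t < i + l) × (toℕ (w t) ≡ x)) → x ∈I (h , l)
      from x (t , i≤t , t<i+l , wt≡x) =
        subst (_∈I (h , l)) (trans (val-toℕ t) wt≡x) (image B (toℕ t) (i≤t , t<i+l))

  -- Counting both ways shows that the two ranges have the same length.
  block-from-⇔ : ∀ {q m g c} → 1 ≤ m → q + m ≤ n →
    (∀ p → p < n → (p ∈I (q , m)) ⇔ (val p ∈I (g , c))) →
    (∀ x → x ∈I (g , c) → ∃ λ p → p < n × val p ≡ x) → (m ≡ c) × Block q g c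
  block-from-⇔ {q} {m} {g} {c} m≥1 q+m≤n pos⇔val hit = m≡c , record
    { nonempty = subst (1 ≤_) m≡c m≥1 ; fits = subst (λ z → q + z ≤ n) m≡c q+m≤n
    ; image = image′ ; onto = onto′ }
    where
      to : ∀ {p} → p ∈I (q , m) → val p ∈I (g , c)
      to p∈ = Equivalence.to (pos⇔val _ (∈I-fits q+m≤n p∈)) p∈
      f : Fin m → ℕ
      f y = val (q + toℕ y)
      f-inj : ∀ x y → f x ≡ f y → x ≡ y
      f-inj x y eq = FP.toℕ-injective (+-cancelˡ-≡ q _ _
        (val-injective (∈I-fits q+m≤n (∈I-offset q x)) (∈I-fits q+m≤n (∈I-offset q y)) eq))
      f′ : Fin c → ℕ
      f′ y = proj₁ (hit (g + toℕ y) (∈I-offset g y))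
      f′-inj : ∀ x y → f′ x ≡ f′ y → x ≡ y
      f′-inj x y eq with hit (g + toℕ x) (∈I-offset g x) | hit (g + toℕ y) (∈I-offset g y)
      ... | _ , _ , e₁ | _ , _ , e₂ = FP.toℕ-injective (+-cancelˡ-≡ g _ _ (trans (sym e₁) (trans (cong val eq) e₂)))
      f′∈ : ∀ y → f′ y ∈I (q , m)
      f′∈ y with hit (g + toℕ y) (∈I-offset g y)
      ... | p , p<n , vp≡ = Equivalence.from (pos⇔val p p<n) (subst (_∈I (g , c)) (sym vp≡) (∈I-offset g y))
      m≡c : m ≡ c
      m≡c = ≤-antisym (range-injection⇒≤ f g c f-inj (λ y → to (∈I-offset q y)))
                      (range-injection⇒≤ f′ q m f′-inj f′∈)
      image′ : ∀ p → p ∈I (q , c) → val p ∈I (g , c)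
      image′ p p∈ = to (subst (λ z → p ∈I (q , z)) (sym m≡c) p∈)
      onto′ : ∀ x → x ∈I (g , c) → ∃ λ p → p ∈I (q , c) × val p ≡ x
      onto′ x x∈ with hit x x∈
      ... | p , p<n , vp≡x = p ,
        subst (λ z → p ∈I (q , z)) m≡c (Equivalence.from (pos⇔val p p<n) (subst (_∈I (g , c)) (sym vp≡x) x∈)) , vp≡x

  block-from-bounds : ∀ {q e g f} → q < e → e ≤ n → g ≤ f →
    (∀ p → p < n → (q ≤ p × p < e) ⇔ (g ≤ val p × val p < f)) →
    (∀ x → g ≤ x × x < f → ∃ λ p → p < n × val p ≡ x) → (e ∸ q ≡ f ∸ g) × Block q g (f ∸ g)
  block-from-bounds q<e e≤n g≤f pos⇔val hit =
    block-from-⇔ (m<n⇒0<n∸m q<e) (subst (_≤ n) (sym (m+[n∸m]≡n (<⇒≤ q<e))) e≤n)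
      (λ p p<n → ⇔-sym (∈I-∸-⇔ g≤f) ⇔-∘ (pos⇔val p p<n ⇔-∘ ∈I-∸-⇔ (<⇒≤ q<e)))
      (λ x x∈ → hit x (Equivalence.to (∈I-∸-⇔ g≤f) x∈))

  whole-block : 1 ≤ n → Block 0 0 n
  whole-block n≥1 = proj₂ (block-from-⇔ n≥1 ≤-refl
    (λ p p<n → mk⇔ (λ _ → z≤n , val<n p<n) (λ _ → z≤n , p<n))
    (λ x (_ , x<n) → val-surjective x x<n))

  singleton-block : ∀ {p} → p < n → Block p (val p) 1
  singleton-block {p} p<n = record
    { nonempty = ≤-refl ; fits = subst (_≤ n) (+-comm 1 p) p<n
    ; image = λ q q∈ → subst (λ z → val z ∈I (val p , 1)) (sym (∈I-singleton q∈)) (∈I-start (val p) ≤-refl)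
    ; onto = λ x x∈ → p , ∈I-start p ≤-refl , sym (∈I-singleton x∈) }

  blockPattern : ∀ {q g s} → Block q g s → Fin s → Fin s
  blockPattern {q} B y = fromℕ< (∈I⇒∸< (image B (q + toℕ y) (∈I-offset q y)))

  toℕ-blockPattern : ∀ {q g s} (B : Block q g s) y → toℕ (blockPattern B y) ≡ val (q + toℕ y) ∸ g
  toℕ-blockPattern B y = FP.toℕ-fromℕ< _

  blockPattern-injective : ∀ {q g s} (B : Block q g s) → IsPerm (blockPattern B)
  blockPattern-injective {q} {g} B {x} {y} eq = FP.toℕ-injective (+-cancelˡ-≡ q _ _
    (val-injective (∈I-fits (fits B) (∈I-offset q x)) (∈I-fits (fits B) (∈I-offset q y)) (begin
      val (q + toℕ x)           ≡⟨ m+[n∸m]≡n (proj₁ (image B _ (∈I-offset q x))) ⟨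
      g + (val (q + toℕ x) ∸ g) ≡⟨ cong (g +_) (trans (sym (toℕ-blockPattern B x))
                                     (trans (cong toℕ eq) (toℕ-blockPattern B y))) ⟩
      g + (val (q + toℕ y) ∸ g) ≡⟨ m+[n∸m]≡n (proj₁ (image B _ (∈I-offset q y))) ⟩
      val (q + toℕ y)           ∎)))
    where open ≡-Reasoning

  Block⇒SubwordIso : ∀ {q g L} (U : Block q g L) (σ : Fin L → Fin L) →
    (∀ x → toℕ (σ x) ≡ val (q + toℕ x) ∸ g) → SubwordIso w q L σ
  Block⇒SubwordIso {q} U σ σ≡ = refl , λ a b t s t≡ s≡ →
    let g≤a = proj₁ (image U _ (∈I-offset q a)) ; g≤b = proj₁ (image U _ (∈I-offset q b))
        wt = trans (sym (val-toℕ t)) (cong val t≡)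
        ws = trans (sym (val-toℕ s)) (cong val s≡)
    in mk⇔ (λ lt → subst₂ _<_ (sym (σ≡ a)) (sym (σ≡ b)) (Equivalence.to (∸-<-⇔ g≤a g≤b) (subst₂ _<_ wt ws lt)))
           (λ lt → subst₂ _<_ (sym wt) (sym ws) (Equivalence.from (∸-<-⇔ g≤a g≤b) (subst₂ _<_ (σ≡ a) (σ≡ b) lt)))

  private
    offset₂ : ∀ q s₁ {x y} → x ≡ s₁ + y → q + s₁ + y ≡ q + x
    offset₂ q s₁ {x} {y} x≡ = trans (+-assoc q s₁ y) (cong (q +_) (sym x≡))

    offset₃ : ∀ q s₁ s₂ {x y u} → x ≡ s₁ + y → y ≡ s₂ + u → q + s₁ + s₂ + u ≡ q + x
    offset₃ q s₁ s₂ {x} {y} {u} x≡ y≡ = begin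
      q + s₁ + s₂ + u   ≡⟨ trans (+-assoc (q + s₁) s₂ u) (+-assoc q s₁ _) ⟩
      q + (s₁ + (s₂ + u)) ≡⟨ cong (λ z → q + (s₁ + z)) y≡ ⟨
      q + (s₁ + y)      ≡⟨ cong (q +_) x≡ ⟨
      q + x             ∎
      where open ≡-Reasoning

  blocks⇒⊕-sum-interval : ∀ {q s₁ s₂ s₃ g} → Block q g s₁ → Block (q + s₁) (g + s₁) s₂ →
    Block (q + s₁ + s₂) (g + s₁ + s₂) s₃ → Block q g (s₁ + (s₂ + (s₃ + 0))) → HasSumInterval w
  blocks⇒⊕-sum-interval {q} {s₁} {s₂} {s₃} {g} B₁ B₂ B₃ U =
    (g , s₁ + (s₂ + (s₃ + 0))) , q , Block⇒IsIntervalAt U , ps , s≤s (s≤s (s≤s z≤n)) ,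
    (nonempty B₁ , blockPattern-injective B₁) ∷ (nonempty B₂ , blockPattern-injective B₂) ∷
    (nonempty B₃ , blockPattern-injective B₃) ∷ [] ,
    inj₁ (Block⇒SubwordIso U (⨁ ps) value)
    where
      open ≡-Reasoning
      ps : List SizedPerm
      ps = (s₁ , blockPattern B₁) ∷ (s₂ , blockPattern B₂) ∷ (s₃ , blockPattern B₃) ∷ []
      value : ∀ x → toℕ (⨁ ps x) ≡ val (q + toℕ x) ∸ g
      value x with toℕ-⊕ (blockPattern B₁) (blockPattern B₂ ⊕ (blockPattern B₃ ⊕ ⨁ [])) x
      ... | inj₁ (y , x≡ , v≡) = trans v≡ (trans (toℕ-blockPattern B₁ y) (cong (λ z → val (q + z) ∸ g) (sym x≡)))
      ... | inj₂ (y , x≡ , v≡) with toℕ-⊕ (blockPattern B₂) (blockPattern B₃ ⊕ ⨁ []) y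
      ...   | inj₁ (z , y≡ , v≡₂) = begin
              _                                      ≡⟨ v≡ ⟩
              s₁ + _                                 ≡⟨ cong (s₁ +_) (trans v≡₂ (toℕ-blockPattern B₂ z)) ⟩
              s₁ + (val (q + s₁ + toℕ z) ∸ (g + s₁)) ≡⟨ +-∸-shift g s₁ (proj₁ (image B₂ _ (∈I-offset (q + s₁) z))) ⟩
              val (q + s₁ + toℕ z) ∸ g               ≡⟨ cong (λ u → val u ∸ g) (offset₂ q s₁ (trans x≡ (cong (s₁ +_) y≡))) ⟩
              val (q + toℕ x) ∸ g                    ∎
      ...   | inj₂ (z , y≡ , v≡₂) with toℕ-⊕ (blockPattern B₃) (⨁ []) z
      ...     | inj₂ (() , _)
      ...     | inj₁ (u , z≡ , v≡₃) = begin
              _                                                    ≡⟨ v≡ ⟩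
              s₁ + _                                               ≡⟨ cong (s₁ +_) v≡₂ ⟩
              s₁ + (s₂ + _)                                        ≡⟨ cong (λ v → s₁ + (s₂ + v)) (trans v≡₃ (toℕ-blockPattern B₃ u)) ⟩
              s₁ + (s₂ + (val (q + s₁ + s₂ + toℕ u) ∸ (g + s₁ + s₂))) ≡⟨ cong (s₁ +_) (+-∸-shift (g + s₁) s₂ g+s₁+s₂≤) ⟩
              s₁ + (val (q + s₁ + s₂ + toℕ u) ∸ (g + s₁))            ≡⟨ +-∸-shift g s₁ (≤-trans (m≤m+n (g + s₁) s₂) g+s₁+s₂≤) ⟩
              val (q + s₁ + s₂ + toℕ u) ∸ g                          ≡⟨ cong (λ v → val v ∸ g) (offset₃ q s₁ s₂ x≡ (trans y≡ (cong (s₂ +_) z≡))) ⟩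
              val (q + toℕ x) ∸ g                                    ∎
        where g+s₁+s₂≤ = proj₁ (image B₃ _ (∈I-offset (q + s₁ + s₂) u))

  blocks⇒⊖-sum-interval : ∀ {q s₁ s₂ s₃ g} → Block q (g + s₃ + s₂) s₁ → Block (q + s₁) (g + s₃) s₂ →
    Block (q + s₁ + s₂) g s₃ → Block q g (s₁ + (s₂ + (s₃ + 0))) → HasSumInterval w
  blocks⇒⊖-sum-interval {q} {s₁} {s₂} {s₃} {g} B₁ B₂ B₃ U =
    (g , s₁ + (s₂ + (s₃ + 0))) , q , Block⇒IsIntervalAt U , ps , s≤s (s≤s (s≤s z≤n)) ,
    (nonempty B₁ , blockPattern-injective B₁) ∷ (nonempty B₂ , blockPattern-injective B₂) ∷
    (nonempty B₃ , blockPattern-injective B₃) ∷ [] ,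
    inj₂ (Block⇒SubwordIso U (⨀ ps) value)
    where
      open ≡-Reasoning
      ps : List SizedPerm
      ps = (s₁ , blockPattern B₁) ∷ (s₂ , blockPattern B₂) ∷ (s₃ , blockPattern B₃) ∷ []
      s₂₃ = s₂ + (s₃ + 0)
      g≡ : g + s₃ + s₂ ≡ g + s₂₃
      g≡ = trans (+-assoc g s₃ s₂) (cong (g +_) (trans (+-comm s₃ s₂) (cong (s₂ +_) (sym (+-identityʳ s₃)))))
      value : ∀ x → toℕ (⨀ ps x) ≡ val (q + toℕ x) ∸ g
      value x with toℕ-⊖ (blockPattern B₁) (blockPattern B₂ ⊖ (blockPattern B₃ ⊖ ⨀ [])) x
      ... | inj₁ (y , x≡ , v≡) = begin
              _                                    ≡⟨ v≡ ⟩
              s₂₃ + _                              ≡⟨ cong (s₂₃ +_) (toℕ-blockPattern B₁ y) ⟩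
              s₂₃ + (val (q + toℕ y) ∸ (g + s₃ + s₂)) ≡⟨ cong (λ v → s₂₃ + (val (q + toℕ y) ∸ v)) g≡ ⟩
              s₂₃ + (val (q + toℕ y) ∸ (g + s₂₃))  ≡⟨ +-∸-shift g s₂₃ (subst (_≤ val (q + toℕ y)) g≡ (proj₁ (image B₁ _ (∈I-offset q y)))) ⟩
              val (q + toℕ y) ∸ g                  ≡⟨ cong (λ z → val (q + z) ∸ g) (sym x≡) ⟩
              val (q + toℕ x) ∸ g                  ∎
      ... | inj₂ (y , x≡ , v≡) with toℕ-⊖ (blockPattern B₂) (blockPattern B₃ ⊖ ⨀ []) y
      ...   | inj₁ (z , y≡ , v≡₂) = begin
              _                                      ≡⟨ trans v≡ v≡₂ ⟩
              (s₃ + 0) + _                           ≡⟨ cong₂ _+_ (+-identityʳ s₃) (toℕ-blockPattern B₂ z) ⟩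
              s₃ + (val (q + s₁ + toℕ z) ∸ (g + s₃)) ≡⟨ +-∸-shift g s₃ (proj₁ (image B₂ _ (∈I-offset (q + s₁) z))) ⟩
              val (q + s₁ + toℕ z) ∸ g               ≡⟨ cong (λ u → val u ∸ g) (offset₂ q s₁ (trans x≡ (cong (s₁ +_) y≡))) ⟩
              val (q + toℕ x) ∸ g                    ∎
      ...   | inj₂ (z , y≡ , v≡₂) with toℕ-⊖ (blockPattern B₃) (⨀ []) z
      ...     | inj₂ (() , _)
      ...     | inj₁ (u , z≡ , v≡₃) = begin
              _                             ≡⟨ trans v≡ (trans v≡₂ v≡₃) ⟩
              toℕ (blockPattern B₃ u)       ≡⟨ toℕ-blockPattern B₃ u ⟩
              val (q + s₁ + s₂ + toℕ u) ∸ g ≡⟨ cong (λ v → val v ∸ g) (offset₃ q s₁ s₂ x≡ (trans y≡ (cong (s₂ +_) z≡))) ⟩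
              val (q + toℕ x) ∸ g           ∎

  record CrossingBlocks (h l g m : ℕ) : Set where
    field
      meetAt : ℕ
      meet   : Block meetAt g (h + l ∸ g)
      joinAt : ℕ
      join   : Block joinAt h (g + m ∸ h)
      sum    : HasSumInterval w

  private
    transport : ∀ {A B A′ B′ : ℕ → Set} → (∀ p → A p ⇔ A′ p) → (∀ p → p < n → A′ p ⇔ B′ (val p)) →
                (∀ x → B x ⇔ B′ x) → ∀ p → p < n → A p ⇔ B (val p)
    transport a c b p p<n = ⇔-sym (b (val p)) ⇔-∘ (c p p<n ⇔-∘ a p)

    swap-⇔ : ∀ {A B : Set} → (A × B) ⇔ (B × A)
    swap-⇔ = mk⇔ swap swap

  crossing-positions : ∀ {i h l j g m} → Block i h l → Block j g m → h < g → g < h + l → h + l < g + m →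
    (i < j × j < i + l × i + l < j + m) ⊎ (j < i × i < j + m × j + m < i + l)
  crossing-positions {i} {h} {l} {j} {g} {m} X Y h<g g<h+l h+l<g+m with compareRanges i l j m
  ... | crossingˡ i<j j<i+l i+l<j+m = inj₁ (i<j , j<i+l , i+l<j+m)
  ... | crossingʳ j<i i<j+m j+m<i+l = inj₂ (j<i , i<j+m , j+m<i+l)
  ... | within j≤i i+l≤j+m with onto X h (∈I-start h (nonempty X))
  ...   | p , (i≤p , p<i+l) , vp≡h =
          ⊥-elim (<-irrefl refl (<-≤-trans h<g (subst (g ≤_) vp≡h
            (proj₁ (image Y p (≤-trans j≤i i≤p , <-≤-trans p<i+l i+l≤j+m))))))
  crossing-positions {i} {h} {l} {j} {g} {m} X Y h<g g<h+l h+l<g+m | around i≤j j+m≤i+l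
    with onto Y (h + l) (<⇒≤ g<h+l , h+l<g+m)
  ... | p , (j≤p , p<j+m) , vp≡h+l =
          ⊥-elim (<-irrefl refl (subst (_< h + l) vp≡h+l
            (proj₂ (image X p (≤-trans i≤j j≤p , <-≤-trans p<j+m j+m≤i+l)))))
  crossing-positions {i} {h} {l} {j} {g} {m} X Y h<g g<h+l h+l<g+m | apart disjoint
    with onto X g (<⇒≤ h<g , g<h+l)
  ... | p , p∈X , vp≡g = ⊥-elim (separate disjoint)
    where
      p∈Y = preimage Y p (∈I-fits (fits X) p∈X) (subst (_∈I (g , m)) (sym vp≡g) (∈I-start g (nonempty Y)))
      separate : (i + l ≤ j ⊎ j + m ≤ i) → ⊥
      separate (inj₁ i+l≤j) = <-irrefl refl (<-≤-trans (proj₂ p∈X) (≤-trans i+l≤j (proj₁ p∈Y)))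
      separate (inj₂ j+m≤i) = <-irrefl refl (<-≤-trans (proj₂ p∈Y) (≤-trans j+m≤i (proj₁ p∈X)))

  -- X ∖ Y, X ∩ Y, Y ∖ X and X ∪ Y are blocks, in the same position order as their values.
  crossing-blocks-⊕ : ∀ {i h l j g m} → Block i h l → Block j g m → h < g → g < h + l → h + l < g + m →
    i < j → j < i + l → i + l < j + m → CrossingBlocks h l g m
  crossing-blocks-⊕ {i} {h} {l} {j} {g} {m} X Y h<g g<h+l h+l<g+m i<j j<i+l i+l<j+m = record
    { meetAt = j ; meet = proj₂ B₂ ; joinAt = i ; join = proj₂ B∪
    ; sum = blocks⇒⊕-sum-interval (proj₂ B₁) (Block-cong (sym q₂) (sym g₂) refl (proj₂ B₂))
              (Block-cong (sym q₃) (sym g₃) refl (proj₂ B₃))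
              (Block-cong refl refl (sym (∸-telescope₃ (<⇒≤ h<g) (<⇒≤ g<h+l) (<⇒≤ h+l<g+m))) (proj₂ B∪)) }
    where
      module P = Crossing i<j j<i+l i+l<j+m
      module V = Crossing h<g g<h+l h+l<g+m
      B₁ = block-from-bounds {i} {j} {h} {g} i<j (≤-trans (<⇒≤ j<i+l) (fits X)) (<⇒≤ h<g)
             (transport P.onlyˡ (λ p p<n → ∈-⇔ X p p<n ×-⇔ ¬-cong-⇔ (∈-⇔ Y p p<n)) V.onlyˡ)
             (λ x x∈ → onto-< X x (proj₁ (Equivalence.to (V.onlyˡ x) x∈)))
      B₂ = block-from-bounds {j} {i + l} {g} {h + l} j<i+l (fits X) (<⇒≤ g<h+l)
             (transport P.both (λ p p<n → ∈-⇔ X p p<n ×-⇔ ∈-⇔ Y p p<n) V.both)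
             (λ x x∈ → onto-< X x (proj₁ (Equivalence.to (V.both x) x∈)))
      B₃ = block-from-bounds {i + l} {j + m} {h + l} {g + m} i+l<j+m (fits Y) (<⇒≤ h+l<g+m)
             (transport P.onlyʳ (λ p p<n → ¬-cong-⇔ (∈-⇔ X p p<n) ×-⇔ ∈-⇔ Y p p<n) V.onlyʳ)
             (λ x x∈ → onto-< Y x (proj₂ (Equivalence.to (V.onlyʳ x) x∈)))
      B∪ = block-from-bounds {i} {j + m} {h} {g + m} (<-trans i<j (<-trans j<i+l i+l<j+m)) (fits Y)
             (≤-trans (<⇒≤ h<g) (≤-trans (<⇒≤ g<h+l) (<⇒≤ h+l<g+m)))
             (transport P.either (λ p p<n → ∈-⇔ X p p<n ⊎-⇔ ∈-⇔ Y p p<n) V.either)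
             (λ x x∈ → [ onto-< X x , onto-< Y x ]′ (Equivalence.to (V.either x) x∈))
      q₂ : i + (g ∸ h) ≡ j
      q₂ = ∸≡⇒+≡ (<⇒≤ i<j) (proj₁ B₁)
      g₂ : h + (g ∸ h) ≡ g
      g₂ = m+[n∸m]≡n (<⇒≤ h<g)
      q₃ : i + (g ∸ h) + (h + l ∸ g) ≡ i + l
      q₃ = trans (cong (_+ (h + l ∸ g)) q₂) (∸≡⇒+≡ (<⇒≤ j<i+l) (proj₁ B₂))
      g₃ : h + (g ∸ h) + (h + l ∸ g) ≡ h + l
      g₃ = trans (cong (_+ (h + l ∸ g)) g₂) (m+[n∸m]≡n (<⇒≤ g<h+l))

  -- Here the position order of Y ∖ X, X ∩ Y, X ∖ Y is the reverse of their value order.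
  crossing-blocks-⊖ : ∀ {i h l j g m} → Block i h l → Block j g m → h < g → g < h + l → h + l < g + m →
    j < i → i < j + m → j + m < i + l → CrossingBlocks h l g m
  crossing-blocks-⊖ {i} {h} {l} {j} {g} {m} X Y h<g g<h+l h+l<g+m j<i i<j+m j+m<i+l = record
    { meetAt = i ; meet = proj₂ B₂ ; joinAt = j ; join = proj₂ B∪
    ; sum = blocks⇒⊖-sum-interval (Block-cong refl (sym g₁) refl (proj₂ B₁)) (Block-cong (sym q₂) (sym g₂) refl (proj₂ B₂))
              (Block-cong (sym q₃) refl refl (proj₂ B₃))
              (Block-cong refl refl (sym (∸-telescope₃ʳ (<⇒≤ h<g) (<⇒≤ g<h+l) (<⇒≤ h+l<g+m))) (proj₂ B∪)) }
    where
      module P = Crossing j<i i<j+m j+m<i+l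
      module V = Crossing h<g g<h+l h+l<g+m
      B₁ = block-from-bounds {j} {i} {h + l} {g + m} j<i (≤-trans (<⇒≤ i<j+m) (fits Y)) (<⇒≤ h+l<g+m)
             (transport P.onlyˡ (λ p p<n → swap-⇔ ⇔-∘ (∈-⇔ Y p p<n ×-⇔ ¬-cong-⇔ (∈-⇔ X p p<n))) V.onlyʳ)
             (λ x x∈ → onto-< Y x (proj₂ (Equivalence.to (V.onlyʳ x) x∈)))
      B₂ = block-from-bounds {i} {j + m} {g} {h + l} i<j+m (fits Y) (<⇒≤ g<h+l)
             (transport P.both (λ p p<n → swap-⇔ ⇔-∘ (∈-⇔ Y p p<n ×-⇔ ∈-⇔ X p p<n)) V.both)
             (λ x x∈ → onto-< X x (proj₁ (Equivalence.to (V.both x) x∈)))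
      B₃ = block-from-bounds {j + m} {i + l} {h} {g} j+m<i+l (fits X) (<⇒≤ h<g)
             (transport P.onlyʳ (λ p p<n → swap-⇔ ⇔-∘ (¬-cong-⇔ (∈-⇔ Y p p<n) ×-⇔ ∈-⇔ X p p<n)) V.onlyˡ)
             (λ x x∈ → onto-< X x (proj₁ (Equivalence.to (V.onlyˡ x) x∈)))
      B∪ = block-from-bounds {j} {i + l} {h} {g + m} (<-trans j<i (<-trans i<j+m j+m<i+l)) (fits X)
             (≤-trans (<⇒≤ h<g) (≤-trans (<⇒≤ g<h+l) (<⇒≤ h+l<g+m)))
             (transport P.either (λ p p<n → mk⇔ Sum.swap Sum.swap ⇔-∘ (∈-⇔ Y p p<n ⊎-⇔ ∈-⇔ X p p<n)) V.either)
             (λ x x∈ → [ onto-< X x , onto-< Y x ]′ (Equivalence.to (V.either x) x∈))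
      g₁ : h + (g ∸ h) + (h + l ∸ g) ≡ h + l
      g₁ = trans (cong (_+ (h + l ∸ g)) (m+[n∸m]≡n (<⇒≤ h<g))) (m+[n∸m]≡n (<⇒≤ g<h+l))
      q₂ : j + (g + m ∸ (h + l)) ≡ i
      q₂ = ∸≡⇒+≡ (<⇒≤ j<i) (proj₁ B₁)
      g₂ : h + (g ∸ h) ≡ g
      g₂ = m+[n∸m]≡n (<⇒≤ h<g)
      q₃ : j + (g + m ∸ (h + l)) + (h + l ∸ g) ≡ j + m
      q₃ = trans (cong (_+ (h + l ∸ g)) q₂) (∸≡⇒+≡ (<⇒≤ i<j+m) (proj₁ B₂))

  crossing-blocks : ∀ {i h l j g m} → Block i h l → Block j g m → h < g → g < h + l → h + l < g + m →
    CrossingBlocks h l g m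
  crossing-blocks X Y h<g g<h+l h+l<g+m with crossing-positions X Y h<g g<h+l h+l<g+m
  ... | inj₁ (i<j , j<i+l , i+l<j+m) = crossing-blocks-⊕ X Y h<g g<h+l h+l<g+m i<j j<i+l i+l<j+m
  ... | inj₂ (j<i , i<j+m , j+m<i+l) = crossing-blocks-⊖ X Y h<g g<h+l h+l<g+m j<i i<j+m j+m<i+l

  private
    quad : ℕ → ℕ → ℕ → ℕ → Fin 4 → ℕ
    quad a b c d 0F = a
    quad a b c d 1F = b
    quad a b c d 2F = c
    quad a b c d 3F = d

  -- W lists the values of the occurrence in increasing order.
  occurrence⇒Contains : (g : Fin 4 → ℕ) → (∀ a → g a < n) → g 0F < g 1F → g 1F < g 2F → g 2F < g 3F →
    (π : Fin 4 → Fin 4) (W : Fin 4 → ℕ) → (∀ a → val (g a) ≡ W (π a)) →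
    W 0F < W 1F → W 1F < W 2F → W 2F < W 3F → Contains w π
  occurrence⇒Contains g g<n g₀₁ g₁₂ g₂₃ π W val≡ W₀₁ W₁₂ W₂₃ = f , f-increasing , f-iso
    where
      f : Fin 4 → Fin n
      f a = fromℕ< (g<n a)
      f-increasing : ∀ a b → a F.< b → f a F.< f b
      f-increasing a b a<b = subst₂ _<_ (sym (FP.toℕ-fromℕ< (g<n a))) (sym (FP.toℕ-fromℕ< (g<n b)))
        (increasing₄ g g₀₁ g₁₂ g₂₃ a b a<b)
      wf : ∀ a → toℕ (w (f a)) ≡ W (π a)
      wf a = trans (sym (val-fromℕ< (g<n a))) (val≡ a)
      f-iso : ∀ a b → (w (f a) F.< w (f b)) ⇔ (π a F.< π b)
      f-iso a b = increasing₄-⇔ W W₀₁ W₁₂ W₂₃ (π a) (π b) ⇔-∘ mk⇔ (subst₂ _<_ (wf a) (wf b)) (subst₂ _<_ (sym (wf a)) (sym (wf b)))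

  contains-3142 : ∀ {p₀ p₁ p₂ p₃} → p₀ < p₁ → p₁ < p₂ → p₂ < p₃ → p₃ < n →
    val p₁ < val p₃ → val p₃ < val p₀ → val p₀ < val p₂ → Contains w p3142
  contains-3142 {p₀} {p₁} {p₂} {p₃} a b c d =
    occurrence⇒Contains (quad p₀ p₁ p₂ p₃) g<n a b c p3142 (quad (val p₁) (val p₃) (val p₀) (val p₂))
      (λ { 0F → refl ; 1F → refl ; 2F → refl ; 3F → refl })
    where
      g<n : ∀ x → quad p₀ p₁ p₂ p₃ x < n
      g<n 0F = <-trans a (<-trans b (<-trans c d))
      g<n 1F = <-trans b (<-trans c d)
      g<n 2F = <-trans c d
      g<n 3F = d

  contains-2413 : ∀ {p₀ p₁ p₂ p₃} → p₀ < p₁ → p₁ < p₂ → p₂ < p₃ → p₃ < n →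
    val p₂ < val p₀ → val p₀ < val p₃ → val p₃ < val p₁ → Contains w p2413
  contains-2413 {p₀} {p₁} {p₂} {p₃} a b c d =
    occurrence⇒Contains (quad p₀ p₁ p₂ p₃) g<n a b c p2413 (quad (val p₂) (val p₀) (val p₃) (val p₁))
      (λ { 0F → refl ; 1F → refl ; 2F → refl ; 3F → refl })
    where
      g<n : ∀ x → quad p₀ p₁ p₂ p₃ x < n
      g<n 0F = <-trans a (<-trans b (<-trans c d))
      g<n 1F = <-trans b (<-trans c d)
      g<n 2F = <-trans c d
      g<n 3F = d

  Ascent : ℕ → ℕ → ℕ → Set
  Ascent i c j = ∀ a b → i ≤ a → a < c → c ≤ b → b < j → val a < val b

  Descent : ℕ → ℕ → ℕ → Set
  Descent i c j = ∀ a b → i ≤ a → a < c → c ≤ b → b < j → val b < val a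

  SplitAt : ℕ → ℕ → ℕ → Set
  SplitAt i c j = i < c × c < j × (Ascent i c j ⊎ Descent i c j)

  private
    pinned : ∀ {i a} → i ≤ a → a < suc i → a ≡ i
    pinned i≤a a<1+i = ≤-antisym (≤-pred a<1+i) i≤a

    <-suc⁻ : ∀ {b e} → b < suc e → b < e ⊎ b ≡ e
    <-suc⁻ b<1+e = m≤n⇒m<n∨m≡n (≤-pred b<1+e)

  SplitAt-pair : ∀ i → suc i < n → SplitAt i (suc i) (suc (suc i))
  SplitAt-pair i 1+i<n with <-cmp (val i) (val (suc i))
  ... | tri< lt _ _ = n<1+n i , n<1+n (suc i) , inj₁ (λ a b i≤a a<1+i 1+i≤b b<2+i →
          subst₂ (λ p q → val p < val q) (sym (pinned i≤a a<1+i)) (sym (pinned 1+i≤b b<2+i)) lt)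
  ... | tri> _ _ gt = n<1+n i , n<1+n (suc i) , inj₂ (λ a b i≤a a<1+i 1+i≤b b<2+i →
          subst₂ (λ p q → val q < val p) (sym (pinned i≤a a<1+i)) (sym (pinned 1+i≤b b<2+i)) gt)
  ... | tri≈ _ eq _ = ⊥-elim (<-irrefl (val-injective (<-trans (n<1+n i) 1+i<n) 1+i<n eq) (n<1+n i))

  -- The values before the new last letter u = val e are either split by u at a point c₀
  -- that refines the old split, or an inversion around u yields 3142.
  extend-Ascent : Avoids w p3142 → ∀ {i c e} → i < c → c < e → e < n → Ascent i c e →
    ∃ λ c′ → SplitAt i c′ (suc e)
  extend-Ascent avoid {i} {c} {e} i<c c<e e<n up
    with prefix-or-inversion (λ x → val x <? val e) i c (<⇒≤ i<c)
  ... | inj₁ (y , x , i≤y , y<x , x<c , y≮u , x<u) =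
    ⊥-elim (avoid (contains-3142 y<x x<c c<e e<n x<u (above (<-trans y<x (<-trans x<c c<e)) y≮u)
                                 (up y c i≤y (<-trans y<x x<c) ≤-refl c<e)))
    where
      above : ∀ {x} → x < e → ¬ (val x < val e) → val e < val x
      above x<e ≮ = ≤∧≢⇒< (≮⇒≥ ≮) (λ eq → <-irrefl (val-injective (<-trans x<e e<n) e<n (sym eq)) x<e)
  ... | inj₂ (c₀ , i≤c₀ , c₀≤c , below , notBelow) with c₀ <? c
  ...   | no c₀≮c = c , i<c , <-trans c<e (n<1+n e) , inj₁ λ a b i≤a a<c c≤b b<1+e →
            [ up a b i≤a a<c c≤b , (λ b≡e → subst (λ z → val a < val z) (sym b≡e) (below a i≤a (<-≤-trans a<c (≮⇒≥ c₀≮c)))) ]′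
            (<-suc⁻ b<1+e)
  ...   | yes c₀<c = result
    where
      above : ∀ {x} → x < e → ¬ (val x < val e) → val e < val x
      above x<e ≮ = ≤∧≢⇒< (≮⇒≥ ≮) (λ eq → <-irrefl (val-injective (<-trans x<e e<n) e<n (sym eq)) x<e)
      u<c₀ : val e < val c₀
      u<c₀ = above (<-trans c₀<c c<e) (notBelow c₀ ≤-refl c₀<c)
      ≥c₀-above : ∀ b → c₀ ≤ b → b < e → val e < val b
      ≥c₀-above b c₀≤b b<e with b <? c
      ... | yes b<c = above b<e (notBelow b c₀≤b b<c)
      ... | no b≮c = <-trans u<c₀ (up c₀ b i≤c₀ c₀<c (≮⇒≥ b≮c) b<e)
      result : ∃ λ c′ → SplitAt i c′ (suc e)
      result with i <? c₀
      ... | yes i<c₀ = c₀ , i<c₀ , <-trans (<-trans c₀<c c<e) (n<1+n e) , inj₁ λ a b i≤a a<c₀ c₀≤b b<1+e →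
              <-≤-trans (below a i≤a a<c₀)
                ([ (λ b<e → <⇒≤ (≥c₀-above b c₀≤b b<e)) , (λ b≡e → ≤-reflexive (cong val (sym b≡e))) ]′ (<-suc⁻ b<1+e))
      ... | no i≮c₀ = e , <-trans i<c c<e , n<1+n e , inj₂ λ a b i≤a a<e e≤b b<1+e →
              subst (λ z → val z < val a) (sym (≤-antisym (≤-pred b<1+e) e≤b))
                (≥c₀-above a (≤-trans (≮⇒≥ i≮c₀) i≤a) a<e)

  extend-Descent : Avoids w p2413 → ∀ {i c e} → i < c → c < e → e < n → Descent i c e →
    ∃ λ c′ → SplitAt i c′ (suc e)
  extend-Descent avoid {i} {c} {e} i<c c<e e<n down
    with prefix-or-inversion (λ x → val e <? val x) i c (<⇒≤ i<c)
  ... | inj₁ (y , x , i≤y , y<x , x<c , y≯u , x>u) =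
    ⊥-elim (avoid (contains-2413 y<x x<c c<e e<n (down y c i≤y (<-trans y<x x<c) ≤-refl c<e)
                                 (below (<-trans y<x (<-trans x<c c<e)) y≯u) x>u))
    where
      below : ∀ {x} → x < e → ¬ (val e < val x) → val x < val e
      below x<e ≯ = ≤∧≢⇒< (≮⇒≥ ≯) (λ eq → <-irrefl (val-injective (<-trans x<e e<n) e<n eq) x<e)
  ... | inj₂ (c₀ , i≤c₀ , c₀≤c , above , notAbove) with c₀ <? c
  ...   | no c₀≮c = c , i<c , <-trans c<e (n<1+n e) , inj₂ λ a b i≤a a<c c≤b b<1+e →
            [ down a b i≤a a<c c≤b , (λ b≡e → subst (λ z → val z < val a) (sym b≡e) (above a i≤a (<-≤-trans a<c (≮⇒≥ c₀≮c)))) ]′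
            (<-suc⁻ b<1+e)
  ...   | yes c₀<c = result
    where
      below : ∀ {x} → x < e → ¬ (val e < val x) → val x < val e
      below x<e ≯ = ≤∧≢⇒< (≮⇒≥ ≯) (λ eq → <-irrefl (val-injective (<-trans x<e e<n) e<n eq) x<e)
      c₀<u : val c₀ < val e
      c₀<u = below (<-trans c₀<c c<e) (notAbove c₀ ≤-refl c₀<c)
      ≥c₀-below : ∀ b → c₀ ≤ b → b < e → val b < val e
      ≥c₀-below b c₀≤b b<e with b <? c
      ... | yes b<c = below b<e (notAbove b c₀≤b b<c)
      ... | no b≮c = <-trans (down c₀ b i≤c₀ c₀<c (≮⇒≥ b≮c) b<e) c₀<u
      result : ∃ λ c′ → SplitAt i c′ (suc e)
      result with i <? c₀
      ... | yes i<c₀ = c₀ , i<c₀ , <-trans (<-trans c₀<c c<e) (n<1+n e) , inj₂ λ a b i≤a a<c₀ c₀≤b b<1+e →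
              ≤-<-trans ([ (λ b<e → <⇒≤ (≥c₀-below b c₀≤b b<e)) , (λ b≡e → ≤-reflexive (cong val b≡e)) ]′ (<-suc⁻ b<1+e))
                (above a i≤a a<c₀)
      ... | no i≮c₀ = e , <-trans i<c c<e , n<1+n e , inj₁ λ a b i≤a a<e e≤b b<1+e →
              subst (λ z → val a < val z) (sym (≤-antisym (≤-pred b<1+e) e≤b))
                (≥c₀-below a (≤-trans (≮⇒≥ i≮c₀) i≤a) a<e)

  avoiding⇒SplitAt : Avoids w p2413 → Avoids w p3142 → ∀ i j → suc i < j → j ≤ n → ∃ λ c → SplitAt i c j
  avoiding⇒SplitAt avoid₂₄₁₃ avoid₃₁₄₂ i (suc e) 1+i<1+e 1+e≤n with suc i <? e
  ... | yes 1+i<e with avoiding⇒SplitAt avoid₂₄₁₃ avoid₃₁₄₂ i e 1+i<e (≤-trans (n≤1+n e) 1+e≤n)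
  ...   | c , i<c , c<e , inj₁ up = extend-Ascent avoid₃₁₄₂ i<c c<e 1+e≤n up
  ...   | c , i<c , c<e , inj₂ down = extend-Descent avoid₂₄₁₃ i<c c<e 1+e≤n down
  avoiding⇒SplitAt avoid₂₄₁₃ avoid₃₁₄₂ i (suc e) 1+i<1+e 1+e≤n | no 1+i≮e
    with ≤-antisym (≤-pred 1+i<1+e) (≮⇒≥ 1+i≮e)
  ... | refl = suc i , SplitAt-pair i 1+e≤n

  argmin-val : ∀ a e → a < e → ∃ λ s → a ≤ s × s < e × (∀ s′ → a ≤ s′ → s′ < e → val s ≤ val s′)
  argmin-val a (suc e) a<1+e with a <? e
  ... | no a≮e = a , ≤-refl , a<1+e , λ s′ a≤s′ s′<1+e →
          ≤-reflexive (cong val (sym (≤-antisym (≤-trans (≤-pred s′<1+e) (≮⇒≥ a≮e)) a≤s′)))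
  ... | yes a<e with argmin-val a e a<e
  ...   | s , a≤s , s<e , least with val s ≤? val e
  ...     | yes vs≤ve = s , a≤s , <-trans s<e (n<1+n e) , λ s′ a≤s′ s′<1+e →
              [ least s′ a≤s′ , (λ s′≡e → subst (λ z → val s ≤ val z) (sym s′≡e) vs≤ve) ]′ (m≤n⇒m<n∨m≡n (≤-pred s′<1+e))
  ...     | no vs≰ve = e , <⇒≤ a<e , n<1+n e , λ s′ a≤s′ s′<1+e →
              [ (λ s′<e → ≤-trans (<⇒≤ (≰⇒> vs≰ve)) (least s′ a≤s′ s′<e)) , (λ s′≡e → ≤-reflexive (cong val (sym s′≡e))) ]′
              (m≤n⇒m<n∨m≡n (≤-pred s′<1+e))

  record Halving (i h l : ℕ) : Set where
    field
      kˡ kʳ hˡ hʳ : ℕ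
      kˡ≥1        : 1 ≤ kˡ
      kʳ≥1        : 1 ≤ kʳ
      kˡ+kʳ≡l     : kˡ + kʳ ≡ l
      left        : Block i hˡ kˡ
      right       : Block (i + kˡ) hʳ kʳ
      orientation : (hˡ ≡ h × hʳ ≡ h + kˡ) ⊎ (hʳ ≡ h × hˡ ≡ h + kʳ)

  private
    ∸≥1 : ∀ {a b} c d → a < b → b ∸ a ≡ d ∸ c → 1 ≤ d ∸ c
    ∸≥1 c d a<b eq = subst (1 ≤_) eq (m<n⇒0<n∸m a<b)

  -- The split value is the least value u to the right of the split point.
  Ascent⇒Halving : ∀ {i h l c} → Block i h l → i < c → c < i + l → Ascent i c (i + l) →
    Σ (Halving i h l) λ H → i + Halving.kˡ H ≡ c
  Ascent⇒Halving {i} {h} {l} {c} B i<c c<i+l up = record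
    { kˡ = u ∸ h ; kʳ = h + l ∸ u ; hˡ = h ; hʳ = u
    ; kˡ≥1 = ∸≥1 h u i<c (proj₁ Bˡ) ; kʳ≥1 = ∸≥1 u (h + l) c<i+l (proj₁ Bʳ)
    ; kˡ+kʳ≡l = trans (∸-telescope h≤u (<⇒≤ u<h+l)) (m+n∸m≡n h l)
    ; left = proj₂ Bˡ ; right = Block-cong (sym (∸≡⇒+≡ (<⇒≤ i<c) (proj₁ Bˡ))) refl refl (proj₂ Bʳ)
    ; orientation = inj₁ (refl , sym (m+[n∸m]≡n h≤u)) } , ∸≡⇒+≡ (<⇒≤ i<c) (proj₁ Bˡ)
    where
      m = argmin-val c (i + l) c<i+l
      s = proj₁ m
      c≤s = proj₁ (proj₂ m)
      s<i+l = proj₁ (proj₂ (proj₂ m))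
      least = proj₂ (proj₂ (proj₂ m))
      u = val s
      u∈ = image B s (≤-trans (<⇒≤ i<c) c≤s , s<i+l)
      h≤u : h ≤ u
      h≤u = proj₁ u∈
      u<h+l : u < h + l
      u<h+l = proj₂ u∈
      Bˡ = block-from-bounds {i} {c} {h} {u} i<c (≤-trans (<⇒≤ c<i+l) (fits B)) h≤u
        (λ p p<n → mk⇔
          (λ (i≤p , p<c) → proj₁ (image B p (i≤p , <-trans p<c c<i+l)) , up p s i≤p p<c c≤s s<i+l)
          (λ (h≤vp , vp<u) → let p∈ = preimage B p p<n (h≤vp , <-trans vp<u u<h+l) in
            proj₁ p∈ , ≰⇒> (λ c≤p → <-irrefl refl (<-≤-trans vp<u (least p c≤p (proj₂ p∈))))))
        (λ x (h≤x , x<u) → onto-< B x (h≤x , <-trans x<u u<h+l))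
      Bʳ = block-from-bounds {c} {i + l} {u} {h + l} c<i+l (fits B) (<⇒≤ u<h+l)
        (λ p p<n → mk⇔
          (λ (c≤p , p<i+l) → least p c≤p p<i+l , proj₂ (image B p (≤-trans (<⇒≤ i<c) c≤p , p<i+l)))
          (λ (u≤vp , vp<h+l) → let p∈ = preimage B p p<n (≤-trans h≤u u≤vp , vp<h+l) in
            ≮⇒≥ (λ p<c → <-irrefl refl (<-≤-trans (up p s (proj₁ p∈) p<c c≤s s<i+l) u≤vp)) , proj₂ p∈))
        (λ x (u≤x , x<h+l) → onto-< B x (≤-trans h≤u u≤x , x<h+l))

  -- The split value is the least value u to the left of the split point.
  Descent⇒Halving : ∀ {i h l c} → Block i h l → i < c → c < i + l → Descent i c (i + l) →
    Σ (Halving i h l) λ H → i + Halving.kˡ H ≡ c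
  Descent⇒Halving {i} {h} {l} {c} B i<c c<i+l down = record
    { kˡ = h + l ∸ u ; kʳ = u ∸ h ; hˡ = u ; hʳ = h
    ; kˡ≥1 = ∸≥1 u (h + l) i<c (proj₁ Bˡ) ; kʳ≥1 = ∸≥1 h u c<i+l (proj₁ Bʳ)
    ; kˡ+kʳ≡l = trans (+-comm (h + l ∸ u) (u ∸ h)) (trans (∸-telescope h≤u (<⇒≤ u<h+l)) (m+n∸m≡n h l))
    ; left = proj₂ Bˡ ; right = Block-cong (sym (∸≡⇒+≡ (<⇒≤ i<c) (proj₁ Bˡ))) refl refl (proj₂ Bʳ)
    ; orientation = inj₂ (refl , sym (m+[n∸m]≡n h≤u)) } , ∸≡⇒+≡ (<⇒≤ i<c) (proj₁ Bˡ)
    where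
      m = argmin-val i c i<c
      s = proj₁ m
      i≤s = proj₁ (proj₂ m)
      s<c = proj₁ (proj₂ (proj₂ m))
      least = proj₂ (proj₂ (proj₂ m))
      u = val s
      u∈ = image B s (i≤s , <-trans s<c c<i+l)
      h≤u : h ≤ u
      h≤u = proj₁ u∈
      u<h+l : u < h + l
      u<h+l = proj₂ u∈
      Bˡ = block-from-bounds {i} {c} {u} {h + l} i<c (≤-trans (<⇒≤ c<i+l) (fits B)) (<⇒≤ u<h+l)
        (λ p p<n → mk⇔
          (λ (i≤p , p<c) → least p i≤p p<c , proj₂ (image B p (i≤p , <-trans p<c c<i+l)))
          (λ (u≤vp , vp<h+l) → let p∈ = preimage B p p<n (≤-trans h≤u u≤vp , vp<h+l) in
            proj₁ p∈ , ≰⇒> (λ c≤p → <-irrefl refl (<-≤-trans (down s p i≤s s<c c≤p (proj₂ p∈)) u≤vp))))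
        (λ x (u≤x , x<h+l) → onto-< B x (≤-trans h≤u u≤x , x<h+l))
      Bʳ = block-from-bounds {c} {i + l} {h} {u} c<i+l (fits B) h≤u
        (λ p p<n → mk⇔
          (λ (c≤p , p<i+l) → proj₁ (image B p (≤-trans (<⇒≤ i<c) c≤p , p<i+l)) , down s p i≤s s<c c≤p p<i+l)
          (λ (h≤vp , vp<u) → let p∈ = preimage B p p<n (h≤vp , <-trans vp<u u<h+l) in
            ≮⇒≥ (λ p<c → <-irrefl refl (<-≤-trans vp<u (least p (proj₁ p∈) p<c))) , proj₂ p∈))
        (λ x (h≤x , x<u) → onto-< B x (h≤x , <-trans x<u u<h+l))

  SplitAt⇒Halving : ∀ {i h l c} → Block i h l → SplitAt i c (i + l) → Σ (Halving i h l) λ H → i + Halving.kˡ H ≡ c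
  SplitAt⇒Halving B (i<c , c<i+l , inj₁ up) = Ascent⇒Halving B i<c c<i+l up
  SplitAt⇒Halving B (i<c , c<i+l , inj₂ down) = Descent⇒Halving B i<c c<i+l down

  EveryBlockHalves : Set
  EveryBlockHalves = ∀ {i h l} → Block i h l → 2 ≤ l → Halving i h l

  avoiding⇒halvings : Avoids w p2413 → Avoids w p3142 → EveryBlockHalves
  avoiding⇒halvings avoid₂₄₁₃ avoid₃₁₄₂ {i} {h} {l} B l≥2 =
    proj₁ (SplitAt⇒Halving B (proj₂ (avoiding⇒SplitAt avoid₂₄₁₃ avoid₃₁₄₂ i (i + l) 2+i≤i+l (fits B))))
    where
      2+i≤i+l : suc i < i + l
      2+i≤i+l = subst (_≤ i + l) (+-comm i 2) (+-monoʳ-≤ i l≥2)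

  Interval : ℕ × ℕ → Set
  Interval = IsInterval w

  _≟I_ : (A B : ℕ × ℕ) → Dec (A ≡ B)
  _≟I_ = ≡-dec _≟_ _≟_

  Interval⇒Block : ∀ {h l} → Interval (h , l) → ∃ λ i → Block i h l
  Interval⇒Block (i , at) = i , IsIntervalAt⇒Block at

  Block⇒Interval : ∀ {i h l} → Block i h l → Interval (h , l)
  Block⇒Interval {i} B = i , Block⇒IsIntervalAt B

  length≥1 : ∀ {A} → Interval A → 1 ≤ proj₂ A
  length≥1 (_ , l≥1 , _) = l≥1

  start∈ : ∀ {h l} → Interval (h , l) → h ∈I (h , l)
  start∈ {h} I = ∈I-start h (length≥1 I)

  ⊆I⇒bounds : ∀ {h l g m} → Interval (h , l) → (h , l) ⊆I (g , m) → g ≤ h × h + l ≤ g + m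
  ⊆I⇒bounds {h} {suc l} {g} {m} I ⊆ =
    proj₁ (⊆ h (start∈ I)) , subst (_≤ g + m) (sym (+-suc h l)) (proj₂ (⊆ (h + l) (∈I-last h l)))

  ⊆I-antisym : ∀ {A B} → Interval A → Interval B → A ⊆I B → B ⊆I A → A ≡ B
  ⊆I-antisym {h , l} {g , m} IA IB A⊆B B⊆A with ⊆I⇒bounds IA A⊆B | ⊆I⇒bounds IB B⊆A
  ... | g≤h , h+l≤g+m | h≤g , g+m≤h+l with ≤-antisym h≤g g≤h
  ... | refl = cong (h ,_) (+-cancelˡ-≡ h _ _ (≤-antisym h+l≤g+m g+m≤h+l))

  ⊂I⇒shorter : ∀ {A B} → Interval A → Interval B → A ⊂I B → proj₂ A < proj₂ B
  ⊂I⇒shorter {h , l} {g , m} IA IB (A⊆B , A≢B) with ⊆I⇒bounds IA A⊆B | l <? m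
  ... | _ | yes l<m = l<m
  ... | g≤h , h+l≤g+m | no l≮m = ⊥-elim (A≢B (cong₂ _,_ h≡g (+-cancelˡ-≡ h l m (≤-antisym h+l≤h+m h+m≤h+l))))
    where
      m≤l = ≮⇒≥ l≮m
      h≡g : h ≡ g
      h≡g = ≤-antisym (+-cancelʳ-≤ l h g (≤-trans h+l≤g+m (+-monoʳ-≤ g m≤l))) g≤h
      h+l≤h+m : h + l ≤ h + m
      h+l≤h+m = subst (λ z → h + l ≤ z + m) (sym h≡g) h+l≤g+m
      h+m≤h+l = +-monoʳ-≤ h m≤l

  ⊂I⇒length≥2 : ∀ {A B} → Interval A → Interval B → A ⊂I B → 2 ≤ proj₂ B
  ⊂I⇒length≥2 IA IB A⊂B = ≤-trans (s≤s (length≥1 IA)) (⊂I⇒shorter IA IB A⊂B)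

  ⊆I-whole : ∀ {A} → Interval A → A ⊆I (0 , n)
  ⊆I-whole {h , l} I x x∈ with Interval⇒Block I
  ... | _ , X with onto X x x∈
  ...   | p , p∈ , vp≡x = z≤n , subst (_< n) vp≡x (val<n (∈I-fits (fits X) p∈))

  Interval⇒n≥1 : ∀ {A} → Interval A → 1 ≤ n
  Interval⇒n≥1 {h , l} I with Interval⇒Block I
  ... | i , B = ≤-trans (nonempty B) (≤-trans (m≤n+m l i) (fits B))

  length≤n : ∀ {h l} → Interval (h , l) → l ≤ n
  length≤n {h} {l} I = ≤-trans (m≤n+m l h) (proj₂ (⊆I⇒bounds I (⊆I-whole I)))

  Laminar : Set
  Laminar = ∀ A B → Interval A → Interval B → A ⊆I B ⊎ B ⊆I A ⊎ Disjoint A B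

  laminar-unless-crossing : (∀ {h l g m} → Interval (h , l) → Interval (g , m) → h < g → g < h + l → h + l < g + m → ⊥) →
    Laminar
  laminar-unless-crossing no-crossing (h , l) (g , m) IX IY with compareRanges h l g m
  ... | within g≤h h+l≤g+m = inj₁ (bounds⇒⊆I g≤h h+l≤g+m)
  ... | around h≤g g+m≤h+l = inj₂ (inj₁ (bounds⇒⊆I h≤g g+m≤h+l))
  ... | apart disjoint = inj₂ (inj₂ (apart⇒Disjoint disjoint))
  ... | crossingˡ h<g g<h+l h+l<g+m = ⊥-elim (no-crossing IX IY h<g g<h+l h+l<g+m)
  ... | crossingʳ g<h h<g+m g+m<h+l = ⊥-elim (no-crossing IY IX g<h h<g+m g+m<h+l)

  no-sum-interval⇒laminar : ¬ HasSumInterval w → Laminar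
  no-sum-interval⇒laminar no-sum = laminar-unless-crossing λ IX IY h<g g<h+l h+l<g+m →
    no-sum (CrossingBlocks.sum (crossing-blocks (proj₂ (Interval⇒Block IX)) (proj₂ (Interval⇒Block IY)) h<g g<h+l h+l<g+m))

  Block? : ∀ i h l → Dec (Block i h l)
  Block? i h l with 1 ≤? l | i + l ≤? n | all∈I? (λ p → (h ≤? val p) ×-dec (val p <? h + l)) i l
                | all∈I? (λ x → any∈I? (λ p → val p ≟ x) i l) h l
  ... | yes a | yes b | yes c | yes d = yes (record { nonempty = a ; fits = b ; image = c ; onto = d })
  ... | no ¬a | _ | _ | _ = no λ B → ¬a (nonempty B)
  ... | yes _ | no ¬b | _ | _ = no λ B → ¬b (fits B)
  ... | yes _ | yes _ | no ¬c | _ = no λ B → ¬c (image B)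
  ... | yes _ | yes _ | yes _ | no ¬d = no λ B → ¬d (onto B)

  Interval? : ∀ A → Dec (Interval A)
  Interval? (h , l) with any∈I? (λ i → Block? i h l) 0 (suc n)
  ... | yes (i , _ , B) = yes (Block⇒Interval B)
  ... | no none = no λ I → let (i , B) = Interval⇒Block I in
                   none (i , (z≤n , s≤s (≤-trans (m≤m+n i l) (fits B))) , B)

  ⊂I? : ∀ {A} B → Interval A → Dec (A ⊂I B)
  ⊂I? {h , l} (g , m) I with (g ≤? h) ×-dec (h + l ≤? g + m) | (h , l) ≟I (g , m)
  ... | yes (g≤h , h+l≤g+m) | no A≢B = yes (bounds⇒⊆I g≤h h+l≤g+m , A≢B)
  ... | yes _ | yes A≡B = no λ (_ , A≢B) → A≢B A≡B
  ... | no ¬bounds | _ = no λ (A⊆B , _) → ¬bounds (⊆I⇒bounds I A⊆B)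

  Between : ℕ × ℕ → ℕ × ℕ → Set
  Between A B = ∃ λ C → Interval C × A ⊂I C × C ⊂I B

  -- Every interval lies in [0, n), so C ranges over a finite set.
  Between? : ∀ A B → Interval A → Dec (Between A B)
  Between? A B IA with any∈I? (λ h′ → any∈I? (λ l′ → candidate (h′ , l′)) 0 (suc n)) 0 n
    where
      candidate : ∀ C → Dec (Interval C × A ⊂I C × C ⊂I B)
      candidate C with Interval? C
      ... | no ¬IC = no λ (IC , _) → ¬IC IC
      ... | yes IC with ⊂I? C IA | ⊂I? B IC
      ...   | yes A⊂C | yes C⊂B = yes (IC , A⊂C , C⊂B)
      ...   | no ¬A⊂C | _ = no λ (_ , A⊂C , _) → ¬A⊂C A⊂C
      ...   | yes _ | no ¬C⊂B = no λ (_ , _ , C⊂B) → ¬C⊂B C⊂B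
  ... | yes (h′ , _ , l′ , _ , C) = yes ((h′ , l′) , C)
  ... | no none = no λ { ((h′ , l′) , IC , A⊂C , C⊂B) →
          none (h′ , (z≤n , proj₂ (⊆I-whole IC h′ (start∈ IC))) ,
                l′ , (z≤n , s≤s (≤-trans (m≤n+m l′ h′) (proj₂ (⊆I⇒bounds IC (⊆I-whole IC))))) , IC , A⊂C , C⊂B) }

  covered-above : ∀ fuel A B → Interval A → Interval B → A ⊂I B → proj₂ B ∸ proj₂ A ≤ fuel →
    ∃ λ C → Covers w B C × A ⊆I C
  covered-above zero A B IA IB A⊂B gap≤0 =
    ⊥-elim (<-irrefl refl (<-≤-trans (m<n⇒0<n∸m (⊂I⇒shorter IA IB A⊂B)) gap≤0))
  covered-above (suc fuel) A B IA IB A⊂B gap≤ with Between? A B IA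
  ... | no nothing = A , (IA , IB , A⊂B , λ C IC A⊂C C⊂B → nothing (C , IC , A⊂C , C⊂B)) , ⊆I-refl
  ... | yes (C , IC , A⊂C , C⊂B)
    with covered-above fuel C B IC IB C⊂B
           (≤-pred (≤-trans (∸-monoʳ-< (⊂I⇒shorter IA IC A⊂C) (<⇒≤ (⊂I⇒shorter IC IB C⊂B))) gap≤))
  ...   | D , B⋗D , C⊆D = D , B⋗D , ⊆I-trans (proj₁ A⊂C) C⊆D

  HasseAdj-sym : ∀ {A B} → HasseAdj w A B → HasseAdj w B A
  HasseAdj-sym = Sum.swap

  module _ (laminar : Laminar) where

    unique-cover-above : ∀ {A B₁ B₂} → Covers w B₁ A → Covers w B₂ A → B₁ ≡ B₂
    unique-cover-above {B₁ = B₁} {B₂} (_ , IB₁ , A⊂B₁ , tight₁) (_ , IB₂ , A⊂B₂ , tight₂)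
      with laminar B₁ B₂ IB₁ IB₂
    ... | inj₁ B₁⊆B₂ with B₁ ≟I B₂
    ...   | yes B₁≡B₂ = B₁≡B₂
    ...   | no B₁≢B₂ = ⊥-elim (tight₂ B₁ IB₁ A⊂B₁ (B₁⊆B₂ , B₁≢B₂))
    unique-cover-above {B₁ = B₁} {B₂} (_ , IB₁ , A⊂B₁ , tight₁) (_ , IB₂ , A⊂B₂ , tight₂) | inj₂ (inj₁ B₂⊆B₁)
      with B₂ ≟I B₁
    ...   | yes B₂≡B₁ = sym B₂≡B₁
    ...   | no B₂≢B₁ = ⊥-elim (tight₁ B₂ IB₂ A⊂B₂ (B₂⊆B₁ , B₂≢B₁))
    unique-cover-above (IA , _ , A⊂B₁ , _) (_ , _ , A⊂B₂ , _) | inj₂ (inj₂ disjoint) =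
      ⊥-elim (disjoint _ (proj₁ A⊂B₁ _ (start∈ IA)) (proj₁ A⊂B₂ _ (start∈ IA)))

    cover-⊆I : ∀ {A B U} → Covers w B A → Interval U → A ⊂I U → B ⊆I U
    cover-⊆I {B = B} {U} (_ , IB , _ , tight) IU A⊂U with laminar B U IB IU
    ... | inj₁ B⊆U = B⊆U
    ... | inj₂ (inj₁ U⊆B) with U ≟I B
    ...   | yes refl = ⊆I-refl
    ...   | no U≢B = ⊥-elim (tight U IU A⊂U (U⊆B , U≢B))
    cover-⊆I (IA , _ , A⊂B , _) _ A⊂U | inj₂ (inj₂ disjoint) =
      ⊥-elim (disjoint _ (proj₁ A⊂B _ (start∈ IA)) (proj₁ A⊂U _ (start∈ IA)))

    -- An edge leaves the intervals below t only through the unique cover p of t.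
    adjacent-stays-below : ∀ {p t a b} → Covers w p t → a ⊆I t → HasseAdj w a b → b ≢ p → b ⊆I t
    adjacent-stays-below p⋗t a⊆t (inj₁ (_ , _ , (b⊆a , _) , _)) b≢p = ⊆I-trans b⊆a a⊆t
    adjacent-stays-below {t = t} {a} p⋗t a⊆t (inj₂ b⋗a) b≢p with a ≟I t
    ... | yes refl = ⊥-elim (b≢p (unique-cover-above b⋗a p⋗t))
    ... | no a≢t = cover-⊆I b⋗a (proj₁ p⋗t) (a⊆t , a≢t)

    walk-stays-below : ∀ {p t} → Covers w p t → ∀ y ys → y ⊆I t → Linked (HasseAdj w) (y ∷ ys) →
      All (_≢ p) ys → All (_⊆I t) ys
    walk-stays-below p⋗t y [] y⊆t _ _ = []
    walk-stays-below p⋗t y (z ∷ zs) y⊆t (r ∷ rs) (z≢p ∷ zs≢p) =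
      let z⊆t = adjacent-stays-below p⋗t y⊆t r z≢p in z⊆t ∷ walk-stays-below p⋗t z zs z⊆t rs zs≢p

    walk-into-stays-below : ∀ {p t} → Covers w p t → ∀ xs → Linked (HasseAdj w) (xs ++ t ∷ [ p ]) →
      All (_≢ p) xs → All (_⊆I t) xs
    walk-into-stays-below p⋗t [] _ _ = []
    walk-into-stays-below p⋗t (x ∷ []) (r ∷ _) (x≢p ∷ []) = adjacent-stays-below p⋗t ⊆I-refl (HasseAdj-sym r) x≢p ∷ []
    walk-into-stays-below p⋗t (x ∷ x′ ∷ xs) (r ∷ rs) (x≢p ∷ xs≢p) with walk-into-stays-below p⋗t (x′ ∷ xs) rs xs≢p
    ... | x′⊆t ∷ rest = adjacent-stays-below p⋗t x′⊆t (HasseAdj-sym r) x≢p ∷ x′⊆t ∷ rest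

    -- If v covers v₁ the rest of the cycle stays below v₁, and if v covers vₗ it stays below
    -- vₗ; each of the four cases for the edges v — v₁ and vₗ — v then contradicts antisymmetry
    -- or the uniqueness of covers.
    no-cycle : ∀ v v₁ mid vₗ → Unique (v ∷ v₁ ∷ mid ++ [ vₗ ]) →
      Linked (HasseAdj w) ((v ∷ v₁ ∷ mid ++ [ vₗ ]) ++ [ v ]) → ⊥
    no-cycle v v₁ mid vₗ ((v≢v₁ ∷ v≢rest) ∷ (v₁≢rest ∷ _)) (first ∷ tail) = close first last
      where
        tail′ : Linked (HasseAdj w) ((v₁ ∷ mid) ++ vₗ ∷ [ v ])
        tail′ = subst (λ z → Linked (HasseAdj w) (v₁ ∷ z)) (++-assoc mid [ vₗ ] [ v ]) tail
        path : Linked (HasseAdj w) (v₁ ∷ mid ++ [ vₗ ])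
        path = proj₁ (Linked-unsnoc (v₁ ∷ mid) tail′)
        last : HasseAdj w vₗ v
        last = proj₂ (Linked-unsnoc (v₁ ∷ mid) tail′)
        rest≢v : All (_≢ v) (mid ++ [ vₗ ])
        rest≢v = All.map (λ ne eq → ne (sym eq)) v≢rest
        v₁≢vₗ : v₁ ≢ vₗ
        v₁≢vₗ = All-last mid v₁≢rest
        vₗ⊆v₁ : Covers w v v₁ → vₗ ⊆I v₁
        vₗ⊆v₁ v⋗v₁ = All-last mid (walk-stays-below v⋗v₁ v₁ (mid ++ [ vₗ ]) ⊆I-refl path rest≢v)
        close : HasseAdj w v v₁ → HasseAdj w vₗ v → ⊥
        close (inj₁ v⋗v₁) (inj₁ vₗ⋗v) = v≢v₁ (⊆I-antisym (proj₁ (proj₂ v⋗v₁)) (proj₁ v⋗v₁)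
          (⊆I-trans (proj₁ (proj₁ (proj₂ (proj₂ vₗ⋗v)))) (vₗ⊆v₁ v⋗v₁)) (proj₁ (proj₁ (proj₂ (proj₂ v⋗v₁)))))
        close (inj₁ v⋗v₁) (inj₂ v⋗vₗ) with vₗ ≟I v₁
        ... | yes vₗ≡v₁ = v₁≢vₗ (sym vₗ≡v₁)
        ... | no vₗ≢v₁ = proj₂ (proj₂ (proj₂ v⋗vₗ)) v₁ (proj₁ v⋗v₁) (vₗ⊆v₁ v⋗v₁ , vₗ≢v₁) (proj₁ (proj₂ (proj₂ v⋗v₁)))
        close (inj₂ v₁⋗v) (inj₁ vₗ⋗v) = v₁≢vₗ (unique-cover-above v₁⋗v vₗ⋗v)
        close (inj₂ v₁⋗v) (inj₂ v⋗vₗ) with walk-into-stays-below v⋗vₗ (v₁ ∷ mid) tail′ ((λ eq → v≢v₁ (sym eq)) ∷ AllP.++⁻ˡ mid rest≢v)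
        ... | v₁⊆vₗ ∷ _ = All-last mid v≢rest (⊆I-antisym (proj₁ v₁⋗v) (proj₁ v⋗vₗ)
          (⊆I-trans (proj₁ (proj₁ (proj₂ (proj₂ v₁⋗v)))) v₁⊆vₗ) (proj₁ (proj₁ (proj₂ (proj₂ v⋗vₗ)))))

    laminar⇒acyclic : HasseAcyclic w
    laminar⇒acyclic [] ()
    laminar⇒acyclic (v ∷ []) (() , _)
    laminar⇒acyclic (v ∷ v₁ ∷ []) (s≤s () , _)
    laminar⇒acyclic (v ∷ v₁ ∷ v₂ ∷ rest) (_ , unique , linked) with snoc-view v₂ rest
    ... | mid , vₗ , eq = no-cycle v v₁ mid vₗ (subst (λ z → Unique (v ∷ v₁ ∷ z)) eq unique)
                            (subst (λ z → Linked (HasseAdj w) ((v ∷ v₁ ∷ z) ++ [ v ])) eq linked)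

  record Bisection (B L R : ℕ × ℕ) : Set where
    field
      intervalˡ : Interval L
      intervalʳ : Interval R
      L⊆B       : L ⊆I B
      R⊆B       : R ⊆I B
      disjoint  : Disjoint L R
      cover     : ∀ x → x ∈I B → x ∈I L ⊎ x ∈I R

  Halving⇒Bisection : ∀ {i h l} (H : Halving i h l) → Bisection (h , l) (Halving.hˡ H , Halving.kˡ H) (Halving.hʳ H , Halving.kʳ H)
  Halving⇒Bisection {h = h} H with Halving.orientation H | Halving.kˡ+kʳ≡l H
                                     | range-halves h (Halving.kˡ H) (Halving.kʳ H) | range-halves h (Halving.kʳ H) (Halving.kˡ H)
  ... | inj₁ (refl , refl) | refl | (L⊆ , R⊆ , disjoint , cover) | _ = record
    { intervalˡ = Block⇒Interval (Halving.left H) ; intervalʳ = Block⇒Interval (Halving.right H)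
    ; L⊆B = L⊆ ; R⊆B = R⊆ ; disjoint = disjoint ; cover = cover }
  ... | inj₂ (refl , refl) | refl | _ | (R⊆ , L⊆ , disjoint , cover) = record
    { intervalˡ = Block⇒Interval (Halving.left H) ; intervalʳ = Block⇒Interval (Halving.right H)
    ; L⊆B = λ x x∈ → commute kʳ kˡ (L⊆ x x∈) ; R⊆B = λ x x∈ → commute kʳ kˡ (R⊆ x x∈)
    ; disjoint = λ x x∈L x∈R → disjoint x x∈R x∈L
    ; cover = λ x x∈ → Sum.swap (cover x (commute kˡ kʳ x∈)) }
    where
      open Halving H using (kˡ; kʳ)
      commute : ∀ a b {x} → x ∈I (h , a + b) → x ∈I (h , b + a)
      commute a b {x} = subst (λ z → x ∈I (h , z)) (+-comm a b)

  module _ (laminar : Laminar) where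

    module _ {B L R : ℕ × ℕ} (IB : Interval B) (bisection : Bisection B L R) where
      open Bisection bisection

      L≢B : L ≢ B
      L≢B refl = disjoint _ (R⊆B _ (start∈ intervalʳ)) (start∈ intervalʳ)

      R≢B : R ≢ B
      R≢B refl = disjoint _ (start∈ intervalˡ) (L⊆B _ (start∈ intervalˡ))

      ⊂-bisected⇒⊆-half : ∀ {A} → Interval A → A ⊂I B → A ⊆I L ⊎ A ⊆I R
      ⊂-bisected⇒⊆-half {A} IA (A⊆B , A≢B) with laminar A L IA intervalˡ
      ... | inj₁ A⊆L = inj₁ A⊆L
      ... | inj₂ (inj₂ A∩L=∅) = inj₂ λ x x∈ → [ (λ x∈L → ⊥-elim (A∩L=∅ x x∈ x∈L)) , (λ x∈R → x∈R) ]′ (cover x (A⊆B x x∈))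
      ... | inj₂ (inj₁ L⊆A) with laminar A R IA intervalʳ
      ...   | inj₁ A⊆R = ⊥-elim (disjoint _ (start∈ intervalˡ) (A⊆R _ (L⊆A _ (start∈ intervalˡ))))
      ...   | inj₂ (inj₁ R⊆A) = ⊥-elim (A≢B (⊆I-antisym IA IB A⊆B (λ x x∈ → [ L⊆A x , R⊆A x ]′ (cover x x∈))))
      ...   | inj₂ (inj₂ A∩R=∅) = inj₁ λ x x∈ → [ (λ x∈L → x∈L) , (λ x∈R → ⊥-elim (A∩R=∅ x x∈ x∈R)) ]′ (cover x (A⊆B x x∈))

      covers-left : Covers w B L
      covers-left = intervalˡ , IB , (L⊆B , L≢B) , λ C IC (L⊆C , L≢C) C⊂B →
        [ (λ C⊆L → L≢C (⊆I-antisym intervalˡ IC L⊆C C⊆L)) ,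
          (λ C⊆R → disjoint _ (start∈ intervalˡ) (C⊆R _ (L⊆C _ (start∈ intervalˡ)))) ]′ (⊂-bisected⇒⊆-half IC C⊂B)

      covers-right : Covers w B R
      covers-right = intervalʳ , IB , (R⊆B , R≢B) , λ C IC (R⊆C , R≢C) C⊂B →
        [ (λ C⊆L → disjoint _ (C⊆L _ (R⊆C _ (start∈ intervalʳ))) (start∈ intervalʳ)) ,
          (λ C⊆R → R≢C (⊆I-antisym intervalʳ IC R⊆C C⊆R)) ]′ (⊂-bisected⇒⊆-half IC C⊂B)

      covered⇒half : ∀ {A} → Covers w B A → A ≡ L ⊎ A ≡ R
      covered⇒half {A} (IA , _ , A⊂B , tight) with ⊂-bisected⇒⊆-half IA A⊂B
      ... | inj₁ A⊆L with A ≟I L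
      ...   | yes A≡L = inj₁ A≡L
      ...   | no A≢L = ⊥-elim (tight L intervalˡ (A⊆L , A≢L) (L⊆B , L≢B))
      covered⇒half {A} (IA , _ , A⊂B , tight) | inj₂ A⊆R with A ≟I R
      ...   | yes A≡R = inj₂ A≡R
      ...   | no A≢R = ⊥-elim (tight R intervalʳ (A⊆R , A≢R) (R⊆B , R≢B))

    module _ (halves : EveryBlockHalves) where

      bisect : ∀ {B A} → Interval B → Interval A → A ⊂I B →
        Σ (ℕ × ℕ) λ L → Σ (ℕ × ℕ) λ R → Bisection B L R × proj₂ L < proj₂ B × proj₂ R < proj₂ B
      bisect {h , l} IB IA A⊂B with Interval⇒Block IB
      ... | i , B with halves B (⊂I⇒length≥2 IA IB A⊂B)
      ... | H = _ , _ , Halving⇒Bisection H ,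
          subst (Halving.kˡ H <_) (Halving.kˡ+kʳ≡l H) (m<m+n _ (Halving.kʳ≥1 H)) ,
          subst (Halving.kʳ H <_) (trans (+-comm (Halving.kʳ H) _) (Halving.kˡ+kʳ≡l H)) (m<m+n _ (Halving.kˡ≥1 H))

      halvings⇒no-element-covers-3 : NoElementCovers3 w
      halvings⇒no-element-covers-3 B A₁ A₂ A₃ B⋗A₁ B⋗A₂ B⋗A₃
        with bisect (proj₁ (proj₂ B⋗A₁)) (proj₁ B⋗A₁) (proj₁ (proj₂ (proj₂ B⋗A₁)))
      ... | L , R , bisection , _ with covered⇒half IB bisection B⋗A₁ | covered⇒half IB bisection B⋗A₂
                                     | covered⇒half IB bisection B⋗A₃
        where IB = proj₁ (proj₂ B⋗A₁)
      ... | inj₁ e₁ | inj₁ e₂ | _       = inj₁ (trans e₁ (sym e₂))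
      ... | inj₂ e₁ | inj₂ e₂ | _       = inj₁ (trans e₁ (sym e₂))
      ... | inj₁ e₁ | inj₂ e₂ | inj₁ e₃ = inj₂ (inj₁ (trans e₁ (sym e₃)))
      ... | inj₁ e₁ | inj₂ e₂ | inj₂ e₃ = inj₂ (inj₂ (trans e₂ (sym e₃)))
      ... | inj₂ e₁ | inj₁ e₂ | inj₂ e₃ = inj₂ (inj₁ (trans e₁ (sym e₃)))
      ... | inj₂ e₁ | inj₁ e₂ | inj₁ e₃ = inj₂ (inj₂ (trans e₂ (sym e₃)))

      walk-up : ∀ fuel B → Interval B → proj₂ B ≤ fuel → ∀ A → Interval A → A ⊆I B → Star (HasseAdj w) A B
      walk-up zero B IB l≤0 A IA A⊆B = ⊥-elim (<-irrefl refl (≤-trans (length≥1 IB) l≤0))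
      walk-up (suc fuel) B IB l≤ A IA A⊆B with A ≟I B
      ... | yes refl = ε
      ... | no A≢B with bisect IB IA (A⊆B , A≢B)
      ...   | L , R , bisection , L<B , R<B with ⊂-bisected⇒⊆-half IB bisection IA (A⊆B , A≢B)
      ...     | inj₁ A⊆L = walk-up fuel L (Bisection.intervalˡ bisection) (≤-pred (≤-trans L<B l≤)) A IA A⊆L
                             ◅◅ (inj₂ (covers-left IB bisection) ◅ ε)
      ...     | inj₂ A⊆R = walk-up fuel R (Bisection.intervalʳ bisection) (≤-pred (≤-trans R<B l≤)) A IA A⊆R
                             ◅◅ (inj₂ (covers-right IB bisection) ◅ ε)

      halvings⇒connected : HasseConnected w
      halvings⇒connected A B IA IB =
        walk-up n whole IW ≤-refl A IA (⊆I-whole IA) ◅◅ reverse HasseAdj-sym (walk-up n whole IW ≤-refl B IB (⊆I-whole IB))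
        where
          whole = (0 , n)
          IW : Interval whole
          IW = Block⇒Interval (whole-block (Interval⇒n≥1 IA))

  module CrossingPair {h l g m} (IX : Interval (h , l)) (IY : Interval (g , m))
                      (h<g : h < g) (g<h+l : g < h + l) (h+l<g+m : h + l < g + m) where

    private
      blocks = crossing-blocks (proj₂ (Interval⇒Block IX)) (proj₂ (Interval⇒Block IY)) h<g g<h+l h+l<g+m

    X Y Z C : ℕ × ℕ
    X = (h , l)
    Y = (g , m)
    Z = (h , g + m ∸ h)
    C = (g , h + l ∸ g)

    IZ : Interval Z
    IZ = Block⇒Interval (CrossingBlocks.join blocks)

    IC : Interval C
    IC = Block⇒Interval (CrossingBlocks.meet blocks)

    Z-end : h + (g + m ∸ h) ≡ g + m
    Z-end = m+[n∸m]≡n (≤-trans (<⇒≤ h<g) (m≤m+n g m))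

    C-end : g + (h + l ∸ g) ≡ h + l
    C-end = m+[n∸m]≡n (<⇒≤ g<h+l)

    X⊂Z : X ⊂I Z
    X⊂Z = earlier-end-⊂I (subst (h + l <_) (sym Z-end) h+l<g+m)

    Y⊂Z : Y ⊂I Z
    Y⊂Z = later-start-⊂I h<g (sym Z-end)

    C⊂X : C ⊂I X
    C⊂X = later-start-⊂I h<g C-end

    C⊂Y : C ⊂I Y
    C⊂Y = earlier-end-⊂I (subst (_< g + m) (sym C-end) h+l<g+m)

    between-X-Z : ∀ {W} → Interval W → X ⊂I W → W ⊂I Z → ∃ λ lW → W ≡ (h , lW) × l < lW × h + lW < g + m
    between-X-Z {hW , lW} IW X⊂W (W⊆Z , W≢Z) with ⊆I⇒bounds IX (proj₁ X⊂W) | ⊆I⇒bounds IW W⊆Z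
    ... | hW≤h , _ | h≤hW , end≤ with ≤-antisym hW≤h h≤hW
    ... | refl = lW , refl , ⊂I⇒shorter IX IW X⊂W ,
      ≤∧≢⇒< (subst (hW + lW ≤_) Z-end end≤) (λ eq → W≢Z (cong (hW ,_) (+-cancelˡ-≡ hW _ _ (trans eq (sym Z-end)))))

    between-Y-Z : ∀ {W} → Interval W → Y ⊂I W → W ⊂I Z →
      ∃₂ λ hW mW → W ≡ (hW , mW) × h < hW × hW ≤ g × m < mW × hW + mW ≡ g + m
    between-Y-Z {hW , mW} IW Y⊂W (W⊆Z , W≢Z) with ⊆I⇒bounds IY (proj₁ Y⊂W) | ⊆I⇒bounds IW W⊆Z
    ... | hW≤g , end≥ | h≤hW , end≤ = hW , mW , refl , h<hW , hW≤g , ⊂I⇒shorter IY IW Y⊂W , same-end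
      where
        same-end : hW + mW ≡ g + m
        same-end = ≤-antisym (subst (hW + mW ≤_) Z-end end≤) end≥
        h<hW : h < hW
        h<hW = ≤∧≢⇒< h≤hW λ h≡hW → W≢Z (cong₂ _,_ (sym h≡hW)
          (+-cancelˡ-≡ h mW _ (trans (cong (_+ mW) h≡hW) (trans same-end (sym Z-end)))))

    between-C-X : ∀ {W} → Interval W → C ⊂I W → W ⊂I X →
      ∃₂ λ hW lW → W ≡ (hW , lW) × h < hW × hW < g × hW + lW ≡ h + l
    between-C-X {hW , lW} IW (C⊆W , C≢W) (W⊆X , W≢X) with ⊆I⇒bounds IC C⊆W | ⊆I⇒bounds IW W⊆X
    ... | hW≤g , end≥ | h≤hW , end≤ = hW , lW , refl , h<hW , hW<g , same-end
      where
        same-end : hW + lW ≡ h + l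
        same-end = ≤-antisym end≤ (subst (_≤ hW + lW) C-end end≥)
        h<hW : h < hW
        h<hW = ≤∧≢⇒< h≤hW λ h≡hW → W≢X (cong₂ _,_ (sym h≡hW)
          (+-cancelˡ-≡ h lW l (trans (cong (_+ lW) h≡hW) same-end)))
        hW<g : hW < g
        hW<g = ≤∧≢⇒< hW≤g λ hW≡g → C≢W (cong₂ _,_ (sym hW≡g)
          (sym (+-cancelˡ-≡ g lW _ (trans (cong (_+ lW) (sym hW≡g)) (trans same-end (sym C-end))))))

    between-C-Y : ∀ {W} → Interval W → C ⊂I W → W ⊂I Y →
      ∃ λ lW → W ≡ (g , lW) × h + l < g + lW × g + lW < g + m
    between-C-Y {hW , lW} IW (C⊆W , C≢W) (W⊆Y , W≢Y) with ⊆I⇒bounds IC C⊆W | ⊆I⇒bounds IW W⊆Y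
    ... | hW≤g , end≥ | g≤hW , end≤ with ≤-antisym hW≤g g≤hW
    ... | refl = lW , refl ,
      ≤∧≢⇒< (subst (_≤ hW + lW) C-end end≥) (λ eq → C≢W (cong (hW ,_) (+-cancelˡ-≡ hW _ lW (trans C-end eq)))) ,
      ≤∧≢⇒< end≤ (λ eq → W≢Y (cong (hW ,_) (+-cancelˡ-≡ hW lW m eq)))

  module _ (acyclic : HasseAcyclic w) where

    module _ {h l g m} (IX : Interval (h , l)) (IY : Interval (g , m))
             (h<g : h < g) (g<h+l : g < h + l) (h+l<g+m : h + l < g + m) where
      open CrossingPair IX IY h<g g<h+l h+l<g+m

      -- An interval strictly between C and X would cross Y, and its union with Y would lie
      -- strictly between Y and Z.
      X-covers-meet : Covers w Z Y → Covers w X C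
      X-covers-meet (_ , _ , _ , tight) = IC , IX , C⊂X , λ W IW C⊂W W⊂X → tight′ W IW C⊂W W⊂X
        where
          tight′ : ∀ W → Interval W → C ⊂I W → W ⊂I X → ⊥
          tight′ W IW C⊂W W⊂X with between-C-X IW C⊂W W⊂X
          ... | hW , lW , refl , h<hW , hW<g , same-end =
            tight _ U.IZ U.Y⊂Z (later-start-⊂I h<hW (trans U.Z-end (sym Z-end)))
            where
              module U = CrossingPair IW IY hW<g (subst (g <_) (sym same-end) g<h+l)
                                      (subst (_< g + m) (sym same-end) h+l<g+m)

      Y-covers-meet : Covers w Z X → Covers w Y C
      Y-covers-meet (_ , _ , _ , tight) = IC , IY , C⊂Y , λ W IW C⊂W W⊂Y → tight′ W IW C⊂W W⊂Y
        where
          tight′ : ∀ W → Interval W → C ⊂I W → W ⊂I Y → ⊥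
          tight′ W IW C⊂W W⊂Y with between-C-Y IW C⊂W W⊂Y
          ... | lW , refl , h+l<g+lW , g+lW<g+m =
            tight _ U.IZ U.X⊂Z (earlier-end-⊂I (subst₂ _<_ (sym U.Z-end) (sym Z-end) g+lW<g+m))
            where
              module U = CrossingPair IX IW h<g g<h+l h+l<g+lW

      join-cannot-cover-both : Covers w Z X → Covers w Z Y → ⊥
      join-cannot-cover-both Z⋗X Z⋗Y = acyclic (C ∷ X ∷ Z ∷ Y ∷ []) (s≤s (s≤s z≤n) , distinct , edges)
        where
          g≢h : g ≢ h
          g≢h g≡h = <-irrefl (sym g≡h) h<g
          C≢Y : C ≢ Y
          C≢Y eq = <-irrefl (cong (g +_) (cong proj₂ eq)) (subst (_< g + m) (sym C-end) h+l<g+m)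
          distinct : Unique (C ∷ X ∷ Z ∷ Y ∷ [])
          distinct = ((λ eq → g≢h (cong proj₁ eq)) ∷ (λ eq → g≢h (cong proj₁ eq)) ∷ C≢Y ∷ [])
                   ∷ (proj₂ X⊂Z ∷ (λ eq → g≢h (sym (cong proj₁ eq))) ∷ [])
                   ∷ ((λ eq → g≢h (sym (cong proj₁ eq))) ∷ [])
                   ∷ [] ∷ []
          edges : Linked (HasseAdj w) ((C ∷ X ∷ Z ∷ Y ∷ []) ++ [ C ])
          edges = inj₂ (X-covers-meet Z⋗Y) ∷ inj₂ Z⋗X ∷ inj₁ Z⋗Y ∷ inj₁ (Y-covers-meet Z⋗X) ∷ [-]

    -- A crossing pair that is not covered by its union can be enlarged to a crossing pair
    -- with a longer member, which can happen only finitely often.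
    no-crossing : ∀ fuel {h l g m} → Interval (h , l) → Interval (g , m) → h < g → g < h + l → h + l < g + m →
      (n ∸ l) + (n ∸ m) < fuel → ⊥
    no-crossing (suc fuel) {h} {l} {g} {m} IX IY h<g g<h+l h+l<g+m μ< with Between? X Z IX
      where open CrossingPair IX IY h<g g<h+l h+l<g+m
    ... | yes (W , IW , X⊂W , W⊂Z) with CrossingPair.between-X-Z IX IY h<g g<h+l h+l<g+m IW X⊂W W⊂Z
    ...   | lW , refl , l<lW , h+lW<g+m =
      no-crossing fuel IW IY h<g (<-≤-trans g<h+l (+-monoʳ-≤ h (<⇒≤ l<lW))) h+lW<g+m
        (<-≤-trans (+-monoˡ-< (n ∸ m) (∸-monoʳ-< l<lW (length≤n IW))) (≤-pred μ<))
    no-crossing (suc fuel) {h} {l} {g} {m} IX IY h<g g<h+l h+l<g+m μ< | no nothing-X-Z with Between? Y Z IY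
      where open CrossingPair IX IY h<g g<h+l h+l<g+m
    ... | yes (W , IW , Y⊂W , W⊂Z) with CrossingPair.between-Y-Z IX IY h<g g<h+l h+l<g+m IW Y⊂W W⊂Z
    ...   | hW , mW , refl , h<hW , hW≤g , m<mW , same-end =
      no-crossing fuel IX IW h<hW (≤-<-trans hW≤g g<h+l) (subst (h + l <_) (sym same-end) h+l<g+m)
        (<-≤-trans (+-monoʳ-< (n ∸ l) (∸-monoʳ-< m<mW (length≤n IW))) (≤-pred μ<))
    no-crossing (suc fuel) {h} {l} {g} {m} IX IY h<g g<h+l h+l<g+m μ< | no nothing-X-Z | no nothing-Y-Z =
      join-cannot-cover-both IX IY h<g g<h+l h+l<g+m
        (IX , IZ , X⊂Z , λ W IW X⊂W W⊂Z → nothing-X-Z (W , IW , X⊂W , W⊂Z))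
        (IY , IZ , Y⊂Z , λ W IW Y⊂W W⊂Z → nothing-Y-Z (W , IW , Y⊂W , W⊂Z))
      where open CrossingPair IX IY h<g g<h+l h+l<g+m

    acyclic⇒laminar : Laminar
    acyclic⇒laminar = laminar-unless-crossing λ IX IY h<g g<h+l h+l<g+m →
      no-crossing _ IX IY h<g g<h+l h+l<g+m ≤-refl

  nested-block-positions : ∀ {j g m i h l} → Block j g m → Block i h l → (g , m) ⊆I (h , l) →
    i ≤ j × j + m ≤ i + l
  nested-block-positions {m = zero} A B _ = ⊥-elim (n≮0 (nonempty A))
  nested-block-positions {j} {m = suc m} {i} {l = l} A B g⊆h =
    proj₁ (inside j (∈I-start j (s≤s z≤n))) ,
    subst (_≤ i + l) (sym (+-suc j m)) (proj₂ (inside (j + m) (∈I-last j m)))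
    where
      inside : ∀ p → p ∈I (j , suc m) → p ∈I (i , l)
      inside p p∈ = preimage B p (∈I-fits (fits A) p∈) (g⊆h _ (image A p p∈))

  module _ (laminar : Laminar) (binary : NoElementCovers3 w) where

    covered-through : ∀ {i h l} → Block i h l → 2 ≤ l → ∀ p → p ∈I (i , l) →
      ∃ λ A → Covers w (h , l) A × val p ∈I A
    covered-through {h = h} {l} B l≥2 p p∈ with covered-above l (val p , 1) (h , l)
      (Block⇒Interval (singleton-block (∈I-fits (fits B) p∈))) (Block⇒Interval B) point⊂B (m∸n≤m l 1)
      where
        vp∈ = image B p p∈
        point⊂B : (val p , 1) ⊂I (h , l)
        point⊂B = bounds⇒⊆I (proj₁ vp∈) (subst (_≤ h + l) (+-comm 1 (val p)) (proj₂ vp∈)) ,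
                  λ eq → <-irrefl (cong proj₂ eq) l≥2
    ... | A , B⋗A , point⊆A = A , B⋗A , point⊆A _ (∈I-start (val p) ≤-refl)

    distinct-covered-disjoint : ∀ {B A₁ A₂ x} → Covers w B A₁ → Covers w B A₂ → x ∈I A₂ → ¬ x ∈I A₁ →
      Disjoint A₁ A₂
    distinct-covered-disjoint {A₁ = A₁} {A₂} B⋗A₁ B⋗A₂ x∈A₂ x∉A₁ with laminar A₁ A₂ (proj₁ B⋗A₁) (proj₁ B⋗A₂)
    ... | inj₂ (inj₂ disjoint) = disjoint
    ... | inj₂ (inj₁ A₂⊆A₁) = ⊥-elim (x∉A₁ (A₂⊆A₁ _ x∈A₂))
    ... | inj₁ A₁⊆A₂ with A₁ ≟I A₂
    ...   | yes refl = ⊥-elim (x∉A₁ x∈A₂)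
    ...   | no A₁≢A₂ = ⊥-elim (proj₂ (proj₂ (proj₂ B⋗A₁)) A₂ (proj₁ B⋗A₂) (A₁⊆A₂ , A₁≢A₂) (proj₁ (proj₂ (proj₂ B⋗A₂))))

    -- The children of B through position i and through the position i + l₁ just after the
    -- first child are its two halves; a child through the next position i + l₁ + l₂ would be
    -- a third one.
    first-child : ∀ {i h l} → Block i h l → 2 ≤ l →
      ∃₂ λ h₁ l₁ → Covers w (h , l) (h₁ , l₁) × Block i h₁ l₁ × l₁ < l
    first-child {i} B l≥2 with covered-through B l≥2 i (∈I-start i (≤-trans (s≤s z≤n) l≥2))
    ... | (h₁ , l₁) , B⋗A , vi∈A with Interval⇒Block (proj₁ B⋗A)
    ...   | i₁ , A = h₁ , l₁ , B⋗A , Block-cong i₁≡i refl refl A , ⊂I⇒shorter (proj₁ B⋗A) (Block⇒Interval B) (proj₁ (proj₂ (proj₂ B⋗A)))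
      where
        i<n : i < n
        i<n = ∈I-fits (fits B) (∈I-start i (≤-trans (s≤s z≤n) l≥2))
        i₁≡i : i₁ ≡ i
        i₁≡i = ≤-antisym (proj₁ (preimage A i i<n vi∈A))
                         (proj₁ (nested-block-positions A B (proj₁ (proj₁ (proj₂ (proj₂ B⋗A))))))

    second-child : ∀ {i h l h₁ l₁} → Block i h l → 2 ≤ l → Covers w (h , l) (h₁ , l₁) → Block i h₁ l₁ → l₁ < l →
      ∃₂ λ h₂ l₂ → Covers w (h , l) (h₂ , l₂) × Block (i + l₁) h₂ l₂ × Disjoint (h₁ , l₁) (h₂ , l₂)
    second-child {i} {h₁ = h₁} {l₁} B l≥2 B⋗A₁ A₁ l₁<l
      with covered-through B l≥2 (i + l₁) (m≤m+n i l₁ , +-monoʳ-< i l₁<l)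
    ... | (h₂ , l₂) , B⋗A₂ , vq∈A₂ with Interval⇒Block (proj₁ B⋗A₂)
    ...   | i₂ , A₂ = h₂ , l₂ , B⋗A₂ , Block-cong i₂≡q refl refl A₂ , disjoint
      where
        q = i + l₁
        q<n : q < n
        q<n = <-≤-trans (+-monoʳ-< i l₁<l) (fits B)
        disjoint : Disjoint (h₁ , l₁) (h₂ , l₂)
        disjoint = distinct-covered-disjoint B⋗A₁ B⋗A₂ vq∈A₂ (λ vq∈A₁ → <-irrefl refl (proj₂ (preimage A₁ q q<n vq∈A₁)))
        i₂≡q : i₂ ≡ q
        i₂≡q with i₂ <? q
        ... | no i₂≮q = ≤-antisym (proj₁ (preimage A₂ q q<n vq∈A₂)) (≮⇒≥ i₂≮q)
        ... | yes i₂<q = ⊥-elim (disjoint _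
              (image A₁ i₂ (proj₁ (nested-block-positions A₂ B (proj₁ (proj₁ (proj₂ (proj₂ B⋗A₂))))) , i₂<q))
              (image A₂ i₂ (∈I-start i₂ (nonempty A₂))))

    children-fill : ∀ {i h l h₁ l₁ h₂ l₂} → Block i h l → 2 ≤ l → Covers w (h , l) (h₁ , l₁) → Block i h₁ l₁ →
      Covers w (h , l) (h₂ , l₂) → Block (i + l₁) h₂ l₂ → Disjoint (h₁ , l₁) (h₂ , l₂) → l₁ + l₂ ≡ l
    children-fill {i} {h} {l} {h₁} {l₁} {h₂} {l₂} B l≥2 B⋗A₁ A₁ B⋗A₂ A₂ disjoint =
      +-cancelˡ-≡ i _ _ (trans (sym (+-assoc i l₁ l₂)) i+l₁+l₂≡i+l)
      where
        i+l₁+l₂≡i+l : i + l₁ + l₂ ≡ i + l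
        i+l₁+l₂≡i+l with i + l₁ + l₂ <? i + l
        ... | no ≮ = ≤-antisym (proj₂ (nested-block-positions A₂ B (proj₁ (proj₁ (proj₂ (proj₂ B⋗A₂)))))) (≮⇒≥ ≮)
        ... | yes r<i+l with covered-through B l≥2 (i + l₁ + l₂) (≤-trans (m≤m+n i l₁) (m≤m+n (i + l₁) l₂) , r<i+l)
        ...   | A₃ , B⋗A₃ , vr∈A₃ = ⊥-elim (three-distinct (binary (h , l) (h₁ , l₁) (h₂ , l₂) A₃ B⋗A₁ B⋗A₂ B⋗A₃))
          where
            r = i + l₁ + l₂
            r<n : r < n
            r<n = <-≤-trans r<i+l (fits B)
            three-distinct : ((h₁ , l₁) ≡ (h₂ , l₂)) ⊎ ((h₁ , l₁) ≡ A₃) ⊎ ((h₂ , l₂) ≡ A₃) → ⊥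
            three-distinct (inj₁ eq) = disjoint h₂ (subst (h₂ ∈I_) (sym eq) (∈I-start h₂ (nonempty A₂))) (∈I-start h₂ (nonempty A₂))
            three-distinct (inj₂ (inj₁ eq)) = <-irrefl refl
              (<-≤-trans (proj₂ (preimage A₁ r r<n (subst (val r ∈I_) (sym eq) vr∈A₃))) (m≤m+n (i + l₁) l₂))
            three-distinct (inj₂ (inj₂ eq)) = <-irrefl refl (proj₂ (preimage A₂ r r<n (subst (val r ∈I_) (sym eq) vr∈A₃)))

    laminar⇒halvings : EveryBlockHalves
    laminar⇒halvings B l≥2 with first-child B l≥2
    ... | h₁ , l₁ , B⋗A₁ , A₁ , l₁<l with second-child B l≥2 B⋗A₁ A₁ l₁<l
    ...   | h₂ , l₂ , B⋗A₂ , A₂ , disjoint = record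
      { kˡ = l₁ ; kʳ = l₂ ; hˡ = h₁ ; hʳ = h₂ ; kˡ≥1 = nonempty A₁ ; kʳ≥1 = nonempty A₂
      ; kˡ+kʳ≡l = l₁+l₂≡l ; left = A₁ ; right = A₂
      ; orientation = disjoint-subranges-tile l₁+l₂≡l (⊆I⇒bounds (proj₁ B⋗A₁) (proj₁ (proj₁ (proj₂ (proj₂ B⋗A₁)))))
                        (⊆I⇒bounds (proj₁ B⋗A₂) (proj₁ (proj₁ (proj₂ (proj₂ B⋗A₂))))) (nonempty A₁) (nonempty A₂) disjoint }
      where
        l₁+l₂≡l = children-fill B l≥2 B⋗A₁ A₁ B⋗A₂ A₂ disjoint

  Halving-separates : ∀ {i h l} (H : Halving i h l) →
    (∀ p q → p ∈I (i , Halving.kˡ H) → q ∈I (i + Halving.kˡ H , Halving.kʳ H) → val p < val q) ⊎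
    (∀ p q → p ∈I (i , Halving.kˡ H) → q ∈I (i + Halving.kˡ H , Halving.kʳ H) → val q < val p)
  Halving-separates H with Halving.orientation H
  ... | inj₁ (hˡ≡h , hʳ≡h+kˡ) = inj₁ λ p q p∈ q∈ →
          <-≤-trans (subst (λ z → val p < z + Halving.kˡ H) hˡ≡h (proj₂ (image (Halving.left H) p p∈)))
                    (subst (_≤ val q) hʳ≡h+kˡ (proj₁ (image (Halving.right H) q q∈)))
  ... | inj₂ (hʳ≡h , hˡ≡h+kʳ) = inj₂ λ p q p∈ q∈ →
          <-≤-trans (subst (λ z → val q < z + Halving.kʳ H) hʳ≡h (proj₂ (image (Halving.right H) q q∈)))
                    (subst (_≤ val p) hˡ≡h+kʳ (proj₁ (image (Halving.left H) p p∈)))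

  module _ (halves : EveryBlockHalves) {π : Fin 4 → Fin 4} (simple : Simple π)
           (g : Fin 4 → ℕ) (g-increasing : ∀ a b → a F.< b → g a < g b) (ordered : OrderedBy π (λ a → val (g a))) where

    private
      g-monotone : ∀ a b → toℕ a ≤ toℕ b → g a ≤ g b
      g-monotone a b a≤b with m≤n⇒m<n∨m≡n a≤b
      ... | inj₁ a<b = <⇒≤ (g-increasing a b a<b)
      ... | inj₂ a≡b = ≤-reflexive (cong g (FP.toℕ-injective a≡b))

    halving-cuts-nothing : ∀ {i h l} (H : Halving i h l) → (∀ a → g a ∈I (i , l)) →
      ∀ (a b : Fin 4) → toℕ b ≡ suc (toℕ a) → g a < i + Halving.kˡ H → i + Halving.kˡ H ≤ g b → ⊥
    halving-cuts-nothing {i} H g∈ a b b≡1+a ga<c c≤gb =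
      simple V ordered (toℕ b) (subst (1 ≤_) (sym b≡1+a) (s≤s z≤n)) (≤-pred (FP.toℕ<n b)) cut
      where
        open Halving H
        V = λ a → val (g a)
        before : ∀ x → toℕ x < toℕ b → g x ∈I (i , kˡ)
        before x x<b = proj₁ (g∈ x) , ≤-<-trans (g-monotone x a (≤-pred (subst (toℕ x <_) b≡1+a x<b))) ga<c
        after : ∀ y → toℕ b ≤ toℕ y → g y ∈I (i + kˡ , kʳ)
        after y b≤y = ≤-trans c≤gb (g-monotone b y b≤y) ,
          subst (g y <_) (trans (cong (i +_) (sym kˡ+kʳ≡l)) (sym (+-assoc i kˡ kʳ))) (proj₂ (g∈ y))
        cut : CutAt V (toℕ b)
        cut with Halving-separates H
        ... | inj₁ below = inj₁ λ x y x<b b≤y → below (g x) (g y) (before x x<b) (after y b≤y)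
        ... | inj₂ above = inj₂ λ x y x<b b≤y → above (g x) (g y) (before x x<b) (after y b≤y)

    -- Descend into the half that contains the whole occurrence g.
    no-occurrence-in-block : ∀ fuel i h l → Block i h l → l ≤ fuel → (∀ a → g a ∈I (i , l)) → ⊥
    no-occurrence-in-block zero i h l B l≤0 _ = n≮0 (≤-trans (nonempty B) l≤0)
    no-occurrence-in-block (suc fuel) i h l B l≤ g∈ = descend
      where
        l≥2 : 2 ≤ l
        l≥2 = +-cancelˡ-≤ i 2 l (subst (_≤ i + l) (+-comm 2 i)
                (≤-trans (s≤s (≤-trans (s≤s (proj₁ (g∈ 0F))) (g-increasing 0F 1F (s≤s z≤n)))) (proj₂ (g∈ 1F))))
        H = halves B l≥2
        open Halving H
        c = i + kˡ
        i+l≡ : i + l ≡ c + kʳ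
        i+l≡ = trans (cong (i +_) (sym kˡ+kʳ≡l)) (sym (+-assoc i kˡ kʳ))
        kˡ≤fuel : kˡ ≤ fuel
        kˡ≤fuel = ≤-pred (≤-trans (subst (kˡ <_) kˡ+kʳ≡l (m<m+n kˡ kʳ≥1)) l≤)
        kʳ≤fuel : kʳ ≤ fuel
        kʳ≤fuel = ≤-pred (≤-trans (subst (kʳ <_) (trans (+-comm kʳ kˡ) kˡ+kʳ≡l) (m<m+n kʳ kˡ≥1)) l≤)
        cut = halving-cuts-nothing H g∈
        descend : ⊥
        descend with g 3F <? c
        ... | yes g₃<c = no-occurrence-in-block fuel i _ kˡ left kˡ≤fuel λ a →
                proj₁ (g∈ a) , ≤-<-trans (g-monotone a 3F (≤-pred (FP.toℕ<n a))) g₃<c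
        ... | no g₃≮c with g 0F <? c
        ...   | no g₀≮c = no-occurrence-in-block fuel c _ kʳ right kʳ≤fuel λ a →
                  ≤-trans (≮⇒≥ g₀≮c) (g-monotone 0F a z≤n) , subst (g a <_) i+l≡ (proj₂ (g∈ a))
        ...   | yes g₀<c with g 1F <? c
        ...     | no g₁≮c = cut 0F 1F refl g₀<c (≮⇒≥ g₁≮c)
        ...     | yes g₁<c with g 2F <? c
        ...       | no g₂≮c = cut 1F 2F refl g₁<c (≮⇒≥ g₂≮c)
        ...       | yes g₂<c = cut 2F 3F refl g₂<c (≮⇒≥ g₃≮c)

  halvings⇒avoids-simple : EveryBlockHalves → ∀ {π} → Simple π → Avoids w π
  halvings⇒avoids-simple halves {π} simple (f , f-increasing , f-iso) =
    no-occurrence-in-block halves simple (λ a → toℕ (f a)) f-increasing ordered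
      n 0 0 n (whole-block (≤-<-trans z≤n (FP.toℕ<n (f 0F)))) ≤-refl (λ a → z≤n , FP.toℕ<n (f a))
    where
      ordered : OrderedBy π (λ a → val (toℕ (f a)))
      ordered a b πa<πb = subst₂ _<_ (sym (val-toℕ (f a))) (sym (val-toℕ (f b))) (Equivalence.from (f-iso a b) πa<πb)

  module _ {i l T} (i+l≤n : i + l ≤ n) {σ : Fin T → Fin T} (subword : SubwordIso w i l σ) where

    private
      l≡T = proj₁ subword
      iso = proj₂ subword

      offset : ∀ p → i ≤ p → p < i + l → ∃ λ (x : Fin T) → toℕ x ≡ p ∸ i
      offset p i≤p p<i+l = fromℕ< x<T , FP.toℕ-fromℕ< x<T
        where x<T = subst (p ∸ i <_) l≡T (∈I⇒∸< (i≤p , p<i+l))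

      reflect : ∀ p q → i ≤ p → p < i + l → i ≤ q → q < i + l → ∀ x y → toℕ x ≡ p ∸ i → toℕ y ≡ q ∸ i →
        toℕ (σ x) < toℕ (σ y) → val p < val q
      reflect p q i≤p p<i+l i≤q q<i+l x y x≡ y≡ σx<σy =
        subst₂ _<_ (sym (val-fromℕ< p<n)) (sym (val-fromℕ< q<n))
          (Equivalence.from (iso x y (fromℕ< p<n) (fromℕ< q<n) (at p<n i≤p x≡) (at q<n i≤q y≡)) σx<σy)
        where
          p<n = <-≤-trans p<i+l i+l≤n
          q<n = <-≤-trans q<i+l i+l≤n
          at : ∀ {r} (r<n : r < n) → i ≤ r → ∀ {z : Fin T} → toℕ z ≡ r ∸ i → toℕ (fromℕ< r<n) ≡ i + toℕ z
          at r<n i≤r z≡ = trans (FP.toℕ-fromℕ< r<n) (trans (sym (m+[n∸m]≡n i≤r)) (cong (i +_) (sym z≡)))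

      across : ∀ K p q → i ≤ p → p < i + K → i + K ≤ q → q < i + l →
        ∃₂ λ x y → toℕ x ≡ p ∸ i × toℕ y ≡ q ∸ i × toℕ x < K × K ≤ toℕ y
      across K p q i≤p p<i+K i+K≤q q<i+l with offset p i≤p (<-trans (<-≤-trans p<i+K i+K≤q) q<i+l)
                                            | offset q (≤-trans (m≤m+n i K) i+K≤q) q<i+l
      ... | x , x≡ | y , y≡ = x , y , x≡ , y≡ ,
        subst (_< K) (sym x≡) (+-cancelˡ-< i _ _ (subst (_< i + K) (sym (m+[n∸m]≡n i≤p)) p<i+K)) ,
        subst (K ≤_) (sym y≡) (+-cancelˡ-≤ i _ _ (subst (i + K ≤_) (sym (m+[n∸m]≡n i≤q)) i+K≤q))
        where i≤q = ≤-trans (m≤m+n i K) i+K≤q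

    ascending-cut⇒Ascent : ∀ K → (∀ x y → toℕ x < K → K ≤ toℕ y → toℕ (σ x) < toℕ (σ y)) → Ascent i (i + K) (i + l)
    ascending-cut⇒Ascent K cut p q i≤p p<i+K i+K≤q q<i+l with across K p q i≤p p<i+K i+K≤q q<i+l
    ... | x , y , x≡ , y≡ , x<K , K≤y =
      reflect p q i≤p (<-trans (<-≤-trans p<i+K i+K≤q) q<i+l) (≤-trans (m≤m+n i K) i+K≤q) q<i+l x y x≡ y≡ (cut x y x<K K≤y)

    descending-cut⇒Descent : ∀ K → (∀ x y → toℕ x < K → K ≤ toℕ y → toℕ (σ y) < toℕ (σ x)) → Descent i (i + K) (i + l)
    descending-cut⇒Descent K cut p q i≤p p<i+K i+K≤q q<i+l with across K p q i≤p p<i+K i+K≤q q<i+l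
    ... | x , y , x≡ , y≡ , x<K , K≤y =
      reflect q p (≤-trans (m≤m+n i K) i+K≤q) q<i+l i≤p (<-trans (<-≤-trans p<i+K i+K≤q) q<i+l) y x y≡ x≡ (cut x y x<K K≤y)

  module _ (laminar : Laminar) where

    no-crossing-blocks : ∀ {i hX kX c hY kY} → Block i hX kX → Block c hY kY → i < c → c < i + kX → i + kX < c + kY → ⊥
    no-crossing-blocks {i} {hX} {kX} {c} {hY} {kY} X Y i<c c<i+kX i+kX<c+kY
      with laminar (hX , kX) (hY , kY) (Block⇒Interval X) (Block⇒Interval Y)
    ... | inj₁ X⊆Y = <-irrefl refl (<-≤-trans i<c (proj₁ (preimage Y i i<n (X⊆Y _ (image X i (∈I-start i (nonempty X)))))))
      where i<n = <-trans i<c (∈I-fits (fits Y) (∈I-start c (nonempty Y)))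
    ... | inj₂ (inj₁ Y⊆X) = <-irrefl refl (proj₂ (preimage X r (∈I-fits (fits Y) r∈Y) (Y⊆X _ (image Y r r∈Y))))
      where
        r = i + kX
        r∈Y : r ∈I (c , kY)
        r∈Y = <⇒≤ c<i+kX , i+kX<c+kY
    ... | inj₂ (inj₂ disjoint) = disjoint _ (image X c (<⇒≤ i<c , c<i+kX)) (image Y c (∈I-start c (nonempty Y)))

    -- The left half of the second halving crosses the right half of the first one.
    two-splits-cross : ∀ {i h l a₁ a₂} → Block i h l → 1 ≤ a₁ → 1 ≤ a₂ → a₁ + a₂ < l →
      SplitAt i (i + a₁) (i + l) → SplitAt i (i + (a₁ + a₂)) (i + l) → ⊥
    two-splits-cross {i} {l = l} {a₁} B a₁≥1 a₂≥1 a₁+a₂<l split₁ split₂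
      with SplitAt⇒Halving B split₁ | SplitAt⇒Halving B split₂
    ... | H₁ , i+kˡ₁≡ | H₂ , i+kˡ₂≡ =
      no-crossing-blocks (Halving.left H₂) (Halving.right H₁)
        (subst (i <_) (sym i+kˡ₁≡) (m<m+n i a₁≥1))
        (subst₂ _<_ (sym i+kˡ₁≡) (sym i+kˡ₂≡) (+-monoʳ-< i (m<m+n a₁ a₂≥1)))
        (subst₂ _<_ (sym i+kˡ₂≡) i+l≡ (+-monoʳ-< i a₁+a₂<l))
      where
        i+l≡ : i + l ≡ i + Halving.kˡ H₁ + Halving.kʳ H₁
        i+l≡ = trans (cong (i +_) (sym (Halving.kˡ+kʳ≡l H₁))) (sym (+-assoc i _ _))

    laminar⇒no-sum-interval : ¬ HasSumInterval w
    laminar⇒no-sum-interval (_ , _ , _ , [] , () , _)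
    laminar⇒no-sum-interval (_ , _ , _ , _ ∷ [] , s≤s () , _)
    laminar⇒no-sum-interval (_ , _ , _ , _ ∷ _ ∷ [] , s≤s (s≤s ()) , _)
    laminar⇒no-sum-interval ((h , l) , i , at , ((a₁ , p₁) ∷ (a₂ , p₂) ∷ (a₃ , p₃) ∷ rest) , _ ,
                             ((a₁≥1 , _) ∷ (a₂≥1 , _) ∷ (a₃≥1 , _) ∷ _) , sum) =
      two-splits-cross B a₁≥1 a₂≥1 (subst (a₁ + a₂ <_) (sym l≡) a₁+a₂<T)
        (split a₁ a₁≥1 (<-≤-trans (m<m+n a₁ a₂≥1) (<⇒≤ a₁+a₂<T)) (cut₁ sum))
        (split (a₁ + a₂) (≤-trans a₁≥1 (m≤m+n a₁ a₂)) a₁+a₂<T (cut₂ sum))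
      where
        B = IsIntervalAt⇒Block at
        R = totalSize rest
        T = a₁ + (a₂ + (a₃ + R))
        a₁+a₂<T : a₁ + a₂ < T
        a₁+a₂<T = +-monoʳ-< a₁ (m<m+n a₂ (≤-trans a₃≥1 (m≤m+n a₃ R)))
        l≡ : l ≡ T
        l≡ = [ proj₁ , proj₁ ]′ sum
        split : ∀ K → 1 ≤ K → K < T → Ascent i (i + K) (i + l) ⊎ Descent i (i + K) (i + l) → SplitAt i (i + K) (i + l)
        split K K≥1 K<T side = m<m+n i K≥1 , +-monoʳ-< i (subst (K <_) (sym l≡) K<T) , side
        cut₁ : _ → Ascent i (i + a₁) (i + l) ⊎ Descent i (i + a₁) (i + l)
        cut₁ (inj₁ iso) = inj₁ (ascending-cut⇒Ascent (fits B) iso a₁ (⊕-separates p₁ _))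
        cut₁ (inj₂ iso) = inj₂ (descending-cut⇒Descent (fits B) iso a₁ (⊖-separates p₁ _))
        cut₂ : _ → Ascent i (i + (a₁ + a₂)) (i + l) ⊎ Descent i (i + (a₁ + a₂)) (i + l)
        cut₂ (inj₁ iso) = inj₁ (ascending-cut⇒Ascent (fits B) iso (a₁ + a₂) (⊕-separates₂ p₁ p₂ _))
        cut₂ (inj₂ iso) = inj₂ (descending-cut⇒Descent (fits B) iso (a₁ + a₂) (⊖-separates₂ p₁ p₂ _))

corollary6p4 : (n : ℕ) (w : Fin n → Fin n) → IsPerm w →
    (HasseIsTree w × NoElementCovers3 w) ⇔
    (Avoids w p2413 × Avoids w p3142 × ¬ HasSumInterval w)
corollary6p4 n w w-inj = mk⇔ tree⇒avoiding avoiding⇒tree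
  where
    open OfPermutation w w-inj

    tree⇒avoiding : HasseIsTree w × NoElementCovers3 w → Avoids w p2413 × Avoids w p3142 × ¬ HasSumInterval w
    tree⇒avoiding ((_ , acyclic) , binary) =
      halvings⇒avoids-simple halves 2413-simple , halvings⇒avoids-simple halves 3142-simple ,
      laminar⇒no-sum-interval laminar
      where
        laminar = acyclic⇒laminar acyclic
        halves = laminar⇒halvings laminar binary

    avoiding⇒tree : Avoids w p2413 × Avoids w p3142 × ¬ HasSumInterval w → HasseIsTree w × NoElementCovers3 w
    avoiding⇒tree (avoid₂₄₁₃ , avoid₃₁₄₂ , no-sum) =
      (halvings⇒connected laminar halves , laminar⇒acyclic laminar) , halvings⇒no-element-covers-3 laminar halves
      where
        laminar = no-sum-interval⇒laminar no-sum
        halves = avoiding⇒halvings avoid₂₄₁₃ avoid₃₁₄₂
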